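{- For any positive integers $n,l,k_1,\ldots,k_{n-1}$ with $n\geq2$, $$z_l\sqcup\!\sqcup_t z_{k_1}\cdots z_{k_{n-1}}=\sum_{i=1}^{n-1}\sum_{\substack{\alpha_1+\cdots+\alpha_{i+1}=l+k_1+\cdots+k_i\\ \alpha_j\geq1}}\prod_{j=1}^{i-1}\binom{\alpha_j-1}{k_j-1}\binom{\alpha_i-1}{k_i-\alpha_{i+1}}\big(z_{\alpha_1}\cdots z_{\alpha_{i+1}}z_{k_{i+1}}\cdots z_{k_{n-1}}-t\,z_{\alpha_1}\cdots z_{\alpha_{i-1}}z_{\alpha_i+\alpha_{i+1}}z_{k_{i+1}}\cdots z_{k_{n-1}}\big)$$ $$+\sum_{\substack{\alpha_1+\cdots+\alpha_n=l+k_1+\cdots+k_{n-1}\\ \alpha_j\geq1}}\prod_{j=1}^{n-1}\binom{\alpha_j-1}{k_j-1}\big(z_{\alpha_1}\cdots z_{\alpha_n}-t\,z_{\alpha_1}\cdots z_{\alpha_{n-2}}z_{\alpha_{n-1}+\alpha_n}\big).$$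
   Context: Let $\mathfrak{h}_t=\mathbb{Q}[t]\langle x,y\rangle$ ($t$ a variable) be the noncommutative polynomial algebra in letters $x,y$, $z_k=x^{k-1}y$. The $t$-shuffle product $\sqcup\!\sqcup_t$ on $\mathfrak{h}_t$ is the $\mathbb{Q}[t]$-bilinear product with $1\sqcup\!\sqcup_tw=w\sqcup\!\sqcup_t1=w$ and $aw_1\sqcup\!\sqcup_t bw_2=a(w_1\sqcup\!\sqcup_t bw_2)+b(aw_1\sqcup\!\sqcup_t w_2)-\delta(w_1)\rho(a)bw_2-\delta(w_2)\rho(b)aw_1$ for words $w_1,w_2$ and letters $a,b$, where $\delta(w)=1$ if $w=1$ and $0$ otherwise, $\rho(x)=0$, $\rho(y)=tx$. Binomial coefficients $\binom{m}{r}$ are $0$ when $r<0$ or $r>m$. -}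

module Defs where

open import Data.Nat as ℕ using (ℕ; zero; suc; _∸_; _≤_)
open import Data.Nat.Combinatorics using (_C_)
open import Data.Integer as ℤ using (ℤ; +_; -[1+_])
open import Data.Rational as ℚ using (ℚ; 0ℚ; 1ℚ)
open import Data.List as L using (List; []; _∷_; _++_; replicate; map; concatMap; filter; foldr; upTo; take; drop; zipWith; length)
open import Data.Product using (_×_; _,_)
open import Relation.Binary.PropositionalEquality using (_≡_; refl)
open import Relation.Nullary using (Dec; yes; no)
open import Relation.Nullary.Decidable using (⌊_⌋)
import Data.List.Properties as LP
open import Data.Nat.ListAction using (sum; product)

data Letter : Set where
  x y : Letter

_≟L_ : (a b : Letter) → Dec (a ≡ b)
x ≟L x = yes refl
x ≟L y = no (λ ())
y ≟L x = no (λ ())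
y ≟L y = yes refl

Word : Set
Word = List Letter

_≟W_ : (u v : Word) → Dec (u ≡ v)
_≟W_ = LP.≡-dec _≟L_

-- Elements of 𝔥_t = ℚ[t]⟨x,y⟩, as finite formal sums of terms  q · t^m · w.
-- Two such sums denote the same element iff all coefficients agree (_≐_).

record Term : Set where
  constructor term
  field
    coef : ℚ
    deg  : ℕ
    word : Word
open Term public

Poly : Set
Poly = List Term

coeff : Poly → ℕ → Word → ℚ
coeff [] m w = 0ℚ
coeff (term q d u ∷ p) m w with d ℕ.≟ m | u ≟W w
... | yes _ | yes _ = q ℚ.+ coeff p m w
... | _     | _     = coeff p m w

_≐_ : Poly → Poly → Set
p ≐ p' = ∀ (m : ℕ) (w : Word) → coeff p m w ≡ coeff p' m w

⟦_⟧ : Word → Poly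
⟦ w ⟧ = term 1ℚ 0 w ∷ []

_⊕_ : Poly → Poly → Poly
_⊕_ = _++_

scale : ℚ → ℕ → Poly → Poly
scale q m = map (λ { (term c d u) → term (q ℚ.* c) (m ℕ.+ d) u })

_⊖_ : Poly → Poly → Poly
p ⊖ p' = p ⊕ scale (ℚ.- 1ℚ) 0 p'

pre : Letter → Poly → Poly
pre a = map (λ { (term c d u) → term c d (a ∷ u) })

Σ-list : {A : Set} → List A → (A → Poly) → Poly
Σ-list xs f = concatMap f xs

-- The t-shuffle product on words (extended Q[t]-bilinearly)
-- aw₁ ⧢ bw₂ = a(w₁ ⧢ bw₂) + b(aw₁ ⧢ w₂) - δ(w₁)ρ(a)bw₂ - δ(w₂)ρ(b)aw₁,
-- ρ(x) = 0, ρ(y) = t x.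

δρ : Word → Letter → Word → Poly
δρ [] y v = term 1ℚ 1 (x ∷ v) ∷ []
δρ [] x v = []
δρ (_ ∷ _) a v = []

_⧢_ : Word → Word → Poly
[] ⧢ w = ⟦ w ⟧
(a ∷ w₁) ⧢ [] = ⟦ a ∷ w₁ ⟧
(a ∷ w₁) ⧢ (b ∷ w₂) =
  ((pre a (w₁ ⧢ (b ∷ w₂)) ⊕ pre b ((a ∷ w₁) ⧢ w₂))
    ⊖ δρ w₁ a (b ∷ w₂))
    ⊖ δρ w₂ b (a ∷ w₁)

z : ℕ → Word
z k = replicate (k ∸ 1) x ++ (y ∷ [])

zs : List ℕ → Word
zs = concatMap z

-- Binomial coefficients, 0 when r < 0 or r > m

binom : ℕ → ℤ → ℕ
binom m (+ r) = m C r
binom m -[1+ _ ] = 0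

_⊝_ : ℕ → ℕ → ℤ
k ⊝ a = (+ k) ℤ.- (+ a)

toℚ : ℕ → ℚ
toℚ n = (+ n) ℚ./ 1

lists : ℕ → ℕ → List (List ℕ)
lists zero N = [] ∷ []
lists (suc p) N = concatMap (λ a → map (a ∷_) (lists p N)) (map suc (upTo N))

compositions : ℕ → ℕ → List (List ℕ)
compositions p N = filter (λ α → sum α ℕ.≟ N) (lists p N)

-- Pieces of the right-hand side.
-- ks = (k₁,…,k_{n-1});  i ranges over 1,…,n-1, written i = suc j.

prodBinom : List ℕ → List ℕ → ℕ
prodBinom αs ks = product (zipWith (λ a k → binom (a ∸ 1) (+ (k ∸ 1))) αs ks)

pairAt : ℕ → List ℕ → ℕ × ℕ
pairAt j α with drop j α
... | a ∷ b ∷ _ = a , b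
... | _ = 0 , 0

headOr0 : List ℕ → ℕ
headOr0 [] = 0
headOr0 (k ∷ _) = k

-- summand for i = suc j, given α = (α₁,…,α_{i+1}):
--  ∏_{j'=1}^{i-1} C(α_{j'}-1,k_{j'}-1) · C(α_i - 1, k_i - α_{i+1}) ·
--  ( z_{α₁}⋯z_{α_{i+1}} z_{k_{i+1}}⋯z_{k_{n-1}}
--    - t z_{α₁}⋯z_{α_{i-1}} z_{α_i+α_{i+1}} z_{k_{i+1}}⋯z_{k_{n-1}} )
innerSummand : List ℕ → ℕ → List ℕ → Poly
innerSummand ks j α with pairAt j α
... | (a , b) =
  scale (toℚ (prodBinom (take j α) ks ℕ.* binom (a ∸ 1) (headOr0 (drop j ks) ⊝ b))) 0
    (⟦ zs α ++ zs (drop (suc j) ks) ⟧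
     ⊖ scale 1ℚ 1 ⟦ zs (take j α) ++ z (a ℕ.+ b) ++ zs (drop (suc j) ks) ⟧)

firstSum : ℕ → List ℕ → Poly
firstSum l ks =
  Σ-list (upTo (length ks)) (λ j →
    Σ-list (compositions (suc (suc j)) (l ℕ.+ sum (take (suc j) ks)))
      (innerSummand ks j))

-- ∑_{α₁+⋯+α_n = l+k₁+⋯+k_{n-1}, αⱼ≥1} ∏_{j=1}^{n-1} C(αⱼ-1,kⱼ-1)
--    ( z_{α₁}⋯z_{α_n} - t z_{α₁}⋯z_{α_{n-2}} z_{α_{n-1}+α_n} )
-- (here n = length ks + 1, so α has length n and j = n-2 = length ks - 1)
secondSum : ℕ → List ℕ → Poly
secondSum l ks =
  Σ-list (compositions (suc (length ks)) (l ℕ.+ sum ks)) (λ α →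
    let j = length ks ∸ 1 in
    let ab = pairAt j α in
    scale (toℚ (prodBinom α ks)) 0
      (⟦ zs α ⟧ ⊖ scale 1ℚ 1 ⟦ zs (take j α) ++ z (Data.Product.proj₁ ab ℕ.+ Data.Product.proj₂ ab) ⟧))

-- Write the right factor as z_{q+1} W.  Peeling the leading letters off both factors with the
-- defining recursion of ⧢_t, and merging the two recursive calls with Pascal's rule, gives by
-- induction on p and q the two-block formula
--   z_{p+1} ⧢ z_{q+1} W = Σ_{j≤q} C(p+j,p) (z_{p+j+1} z_{q−j+1} W − t z_{p+q+2} W)
--                       + Σ_{i≤p} C(q+i,q) z_{q+i+1} (z_{p−i+1} ⧢ W)
--                       − δ(W) t Σ_{i≤p} C(q+i,q) z_{p+q+2}.
-- Its first sum is the i = 1 term of the claimed expansion.  If W is empty, the other two sums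
-- form the final sum (n = 2).  Otherwise they are a weighted sum of shuffles z_l ⧢ W, where W
-- has one block fewer; expanding these by induction on n and putting the block z_{q+i+1} in front,
-- with weight C(q+i, q) = C(α₁ − 1, k₁ − 1), yields the terms i ≥ 2 and the final sum.  The
-- compositions that this reindexing adds all carry a vanishing binomial coefficient.

module Submission where

open import Defs
open import Algebra.Bundles using (CommutativeMonoid)
open import Data.Bool using (true; false)
open import Data.Empty using (⊥-elim)
open import Data.Integer as ℤ using (+_)
import Data.Integer.Properties as ℤP
open import Data.List as L using (List; []; _∷_; _++_; map; replicate; upTo; take; drop; filter; length)
import Data.List.Properties as LP
open import Data.List.Relation.Unary.All using (All; _∷_)
open import Data.Nat as ℕ using (ℕ; zero; suc; _∸_; _≤_; _<_; z≤n; s≤s)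
open import Data.Nat.Combinatorics using (_C_; nCn≡1; nCk+nC[k+1]≡[n+1]C[k+1]; k>n⇒nCk≡0; nCk≡nC[n∸k])
open import Data.Nat.ListAction using (sum)
import Data.Nat.Properties as ℕP
open import Data.Product using (_×_; _,_; proj₁; proj₂)
open import Data.Rational as ℚ using (ℚ; 0ℚ; 1ℚ)
import Data.Rational.Properties as ℚP
import Data.Rational.Unnormalised as ℚᵘ
import Data.Rational.Unnormalised.Properties as ℚᵘP
open import Function using (_∘_)
open import Level using (0ℓ)
open import Relation.Binary.PropositionalEquality using (_≡_; refl; sym; trans; cong; cong₂; subst; module ≡-Reasoning)
import Relation.Binary.Reasoning.Setoid as SetoidReasoning
open import Relation.Nullary using (Dec; yes; no; ¬_; _because_)
open import Relation.Nullary.Decidable using (_×-dec_)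
open import Relation.Unary using (Pred; Decidable)

toℚᵘ-toℚ : ∀ n → ℚ.toℚᵘ (toℚ n) ℚᵘ.≃ ℚᵘ.mkℚᵘ (+ n) 0
toℚᵘ-toℚ n = ℚP.toℚᵘ-fromℚᵘ (ℚᵘ.mkℚᵘ (+ n) 0)

toℚ-+ : ∀ m n → toℚ (m ℕ.+ n) ≡ toℚ m ℚ.+ toℚ n
toℚ-+ m n = ℚP.toℚᵘ-injective (ℚᵘP.≃-trans (toℚᵘ-toℚ (m ℕ.+ n)) (ℚᵘP.≃-trans +-homo
  (ℚᵘP.≃-sym (ℚᵘP.≃-trans (ℚP.toℚᵘ-homo-+ (toℚ m) (toℚ n)) (ℚᵘP.+-cong (toℚᵘ-toℚ m) (toℚᵘ-toℚ n))))))
  where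
  +-homo : ℚᵘ.mkℚᵘ (+ (m ℕ.+ n)) 0 ℚᵘ.≃ ℚᵘ.mkℚᵘ (+ m) 0 ℚᵘ.+ ℚᵘ.mkℚᵘ (+ n) 0
  +-homo = ℚᵘ.*≡* (trans (ℤP.*-identityʳ _) (trans (ℤP.pos-+ m n)
    (trans (cong₂ ℤ._+_ (sym (ℤP.*-identityʳ (+ m))) (sym (ℤP.*-identityʳ (+ n)))) (sym (ℤP.*-identityʳ _)))))

toℚ-* : ∀ m n → toℚ (m ℕ.* n) ≡ toℚ m ℚ.* toℚ n
toℚ-* m n = ℚP.toℚᵘ-injective (ℚᵘP.≃-trans (toℚᵘ-toℚ (m ℕ.* n)) (ℚᵘP.≃-trans *-homo
  (ℚᵘP.≃-sym (ℚᵘP.≃-trans (ℚP.toℚᵘ-homo-* (toℚ m) (toℚ n)) (ℚᵘP.*-cong (toℚᵘ-toℚ m) (toℚᵘ-toℚ n))))))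
  where
  *-homo : ℚᵘ.mkℚᵘ (+ (m ℕ.* n)) 0 ℚᵘ.≃ ℚᵘ.mkℚᵘ (+ m) 0 ℚᵘ.* ℚᵘ.mkℚᵘ (+ n) 0
  *-homo = ℚᵘ.*≡* (trans (ℤP.*-identityʳ _) (trans (ℤP.pos-* m n) (sym (ℤP.*-identityʳ _))))

∸-suc : ∀ {a n} → a < n → n ∸ a ≡ suc (n ∸ suc a)
∸-suc a<n = ℕP.+-∸-assoc 1 a<n

[n+0]Cn≡1 : ∀ n → (n ℕ.+ 0) C n ≡ 1
[n+0]Cn≡1 n = trans (cong (_C n) (ℕP.+-identityʳ n)) (nCn≡1 n)

⊝-≤ : ∀ k b → b ≤ k → k ⊝ b ≡ + (k ∸ b)
⊝-≤ k b b≤k = trans (ℤP.m-n≡m⊖n k b) (ℤP.⊖-≥ b≤k)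

binom-⊝-> : ∀ m k b → k < b → binom m (k ⊝ b) ≡ 0
binom-⊝-> m k b k<b = cong (binom m) (trans (ℤP.m-n≡m⊖n k b) (trans (ℤP.⊖-< k<b) (cong (λ r → ℤ.- (+ r)) (∸-suc k<b))))

binom-complement : ∀ p q j → j ≤ q → binom (p ℕ.+ j) (suc q ⊝ suc (q ∸ j)) ≡ (p ℕ.+ j) C p
binom-complement p q j j≤q = begin
  binom (p ℕ.+ j) (suc q ⊝ suc (q ∸ j))  ≡⟨ cong (binom (p ℕ.+ j)) (⊝-≤ (suc q) (suc (q ∸ j)) (s≤s (ℕP.m∸n≤m q j))) ⟩
  (p ℕ.+ j) C (q ∸ (q ∸ j))              ≡⟨ cong ((p ℕ.+ j) C_) (ℕP.m∸[m∸n]≡n j≤q) ⟩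
  (p ℕ.+ j) C j                          ≡⟨ nCk≡nC[n∸k] (ℕP.m≤n+m j p) ⟩
  (p ℕ.+ j) C (p ℕ.+ j ∸ j)              ≡⟨ cong ((p ℕ.+ j) C_) (ℕP.m+n∸n≡m p j) ⟩
  (p ℕ.+ j) C p                          ∎
  where open ≡-Reasoning

1+p+[1+q+0]≡2+[p+q] : ∀ p q → suc p ℕ.+ (suc q ℕ.+ 0) ≡ suc (suc (p ℕ.+ q))
1+p+[1+q+0]≡2+[p+q] p q = cong suc (trans (ℕP.+-suc p (q ℕ.+ 0)) (cong (λ r → suc (p ℕ.+ r)) (ℕP.+-identityʳ q)))

coeff-here : ∀ {c d u} p {m w} → d ≡ m → u ≡ w → coeff (term c d u ∷ p) m w ≡ c ℚ.+ coeff p m w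
coeff-here {d = d} {u} p {m} {w} d≡m u≡w with d ℕ.≟ m | u ≟W w
... | yes _  | yes _  = refl
... | no d≢m | _      = ⊥-elim (d≢m d≡m)
... | yes _  | no u≢w = ⊥-elim (u≢w u≡w)

coeff-there : ∀ {c d u} p {m w} → ¬ (d ≡ m × u ≡ w) → coeff (term c d u ∷ p) m w ≡ coeff p m w
coeff-there {d = d} {u} p {m} {w} ≢ with d ℕ.≟ m | u ≟W w
... | yes d≡m | yes u≡w = ⊥-elim (≢ (d≡m , u≡w))
... | yes _   | no _    = refl
... | no _    | _       = refl

coeff-++ : ∀ p q m w → coeff (p ++ q) m w ≡ coeff p m w ℚ.+ coeff q m w
coeff-++ [] q m w = sym (ℚP.+-identityˡ _)
coeff-++ (term c d u ∷ p) q m w with (d ℕ.≟ m) ×-dec (u ≟W w)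
... | yes (d≡m , u≡w) = begin
  coeff (term c d u ∷ p ++ q) m w         ≡⟨ coeff-here (p ++ q) d≡m u≡w ⟩
  c ℚ.+ coeff (p ++ q) m w                ≡⟨ cong (c ℚ.+_) (coeff-++ p q m w) ⟩
  c ℚ.+ (coeff p m w ℚ.+ coeff q m w)     ≡⟨ ℚP.+-assoc c _ _ ⟨
  (c ℚ.+ coeff p m w) ℚ.+ coeff q m w     ≡⟨ cong (ℚ._+ coeff q m w) (coeff-here p d≡m u≡w) ⟨
  coeff (term c d u ∷ p) m w ℚ.+ coeff q m w ∎
  where open ≡-Reasoning
... | no ≢ = trans (coeff-there (p ++ q) ≢)
               (trans (coeff-++ p q m w) (cong (ℚ._+ coeff q m w) (sym (coeff-there p ≢))))

-- Equality in 𝔥_t, wrapped in a record so that the polynomials it relates can be inferred.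
infix 4 _≈_
record _≈_ (p q : Poly) : Set where
  constructor mk≈
  field coeff-≡ : p ≐ q
open _≈_

≈-refl : ∀ {p} → p ≈ p
≈-refl = mk≈ λ _ _ → refl

≡⇒≈ : ∀ {p q} → p ≡ q → p ≈ q
≡⇒≈ refl = ≈-refl

⊕-cong : ∀ {p p' q q'} → p ≈ p' → q ≈ q' → p ⊕ q ≈ p' ⊕ q'
⊕-cong {p} {p'} {q} {q'} p≈p' q≈q' = mk≈ λ m w → begin
  coeff (p ⊕ q) m w              ≡⟨ coeff-++ p q m w ⟩
  coeff p m w ℚ.+ coeff q m w    ≡⟨ cong₂ ℚ._+_ (coeff-≡ p≈p' m w) (coeff-≡ q≈q' m w) ⟩
  coeff p' m w ℚ.+ coeff q' m w  ≡⟨ coeff-++ p' q' m w ⟨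
  coeff (p' ⊕ q') m w            ∎
  where open ≡-Reasoning

⊕-commutativeMonoid : CommutativeMonoid _ _
⊕-commutativeMonoid = record
  { Carrier = Poly
  ; _≈_     = _≈_
  ; _∙_     = _⊕_
  ; ε       = []
  ; isCommutativeMonoid = record
    { isMonoid = record
      { isSemigroup = record
        { isMagma = record
          { isEquivalence = record
            { refl  = ≈-refl
            ; sym   = λ e → mk≈ λ m w → sym (coeff-≡ e m w)
            ; trans = λ e f → mk≈ λ m w → trans (coeff-≡ e m w) (coeff-≡ f m w)
            }
          ; ∙-cong = ⊕-cong
          }
        ; assoc = λ p q r → ≡⇒≈ (LP.++-assoc p q r)
        }
      ; identity = (λ _ → ≈-refl) , (λ p → ≡⇒≈ (LP.++-identityʳ p))
      }
    ; comm = λ p q → mk≈ λ m w →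
        trans (coeff-++ p q m w) (trans (ℚP.+-comm (coeff p m w) (coeff q m w)) (sym (coeff-++ q p m w)))
    }
  }

open CommutativeMonoid ⊕-commutativeMonoid
  using (setoid) renaming (sym to ≈-sym; trans to ≈-trans; assoc to ⊕-assoc; comm to ⊕-comm; identityʳ to ⊕-identityʳ)
open import Algebra.Solver.CommutativeMonoid ⊕-commutativeMonoid using (solve; _⊜_) renaming (_⊕_ to _⊞_)
module ≈-Reasoning = SetoidReasoning setoid

module _ (h : Term → Term) where

  coeff-map-outside : ∀ p {m w} → (∀ t → ¬ (deg (h t) ≡ m × word (h t) ≡ w)) →
                      coeff (map h p) m w ≡ 0ℚ
  coeff-map-outside []      outside = refl
  coeff-map-outside (t ∷ p) outside = trans (coeff-there (map h p) (outside t)) (coeff-map-outside p outside)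

  module _ (c : ℚ) {f : ℕ → ℕ} {g : Word → Word}
           (f-inj : ∀ {d e} → f d ≡ f e → d ≡ e) (g-inj : ∀ {u v} → g u ≡ g v → u ≡ v)
           (h-coef : ∀ t → coef (h t) ≡ c ℚ.* coef t)
           (h-deg : ∀ t → deg (h t) ≡ f (deg t)) (h-word : ∀ t → word (h t) ≡ g (word t)) where

    coeff-map-image : ∀ p m w → coeff (map h p) (f m) (g w) ≡ c ℚ.* coeff p m w
    coeff-map-image []      m w = sym (ℚP.*-zeroʳ c)
    coeff-map-image (t ∷ p) m w with (deg t ℕ.≟ m) ×-dec (word t ≟W w)
    ... | yes (d≡m , u≡w) = begin
      coeff (h t ∷ map h p) (f m) (g w)       ≡⟨ coeff-here (map h p) (trans (h-deg t) (cong f d≡m)) (trans (h-word t) (cong g u≡w)) ⟩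
      coef (h t) ℚ.+ coeff (map h p) (f m) (g w) ≡⟨ cong₂ ℚ._+_ (h-coef t) (coeff-map-image p m w) ⟩
      c ℚ.* coef t ℚ.+ c ℚ.* coeff p m w      ≡⟨ ℚP.*-distribˡ-+ c (coef t) (coeff p m w) ⟨
      c ℚ.* (coef t ℚ.+ coeff p m w)          ≡⟨ cong (c ℚ.*_) (coeff-here p d≡m u≡w) ⟨
      c ℚ.* coeff (t ∷ p) m w                 ∎
      where open ≡-Reasoning
    ... | no ≢ = trans (coeff-there (map h p) ≢-image)
                   (trans (coeff-map-image p m w) (cong (c ℚ.*_) (sym (coeff-there p ≢))))
      where
      ≢-image : ¬ (deg (h t) ≡ f m × word (h t) ≡ g w)
      ≢-image (e , e') = ≢ (f-inj (trans (sym (h-deg t)) e) , g-inj (trans (sym (h-word t)) e'))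

neg : Poly → Poly
neg = scale (ℚ.- 1ℚ) 0

infixr 25 _·_
infix 25 t·_
_·_ : ℕ → Poly → Poly
c · p = scale (toℚ c) 0 p

t·_ : Poly → Poly
t·_ = scale 1ℚ 1

coeff-scale₀ : ∀ q p m w → coeff (scale q 0 p) m w ≡ q ℚ.* coeff p m w
coeff-scale₀ q = coeff-map-image _ q (λ e → e) (λ e → e) (λ _ → refl) (λ _ → refl) (λ _ → refl)

coeff-scale₁-zero : ∀ q p w → coeff (scale q 1 p) 0 w ≡ 0ℚ
coeff-scale₁-zero q p w = coeff-map-outside _ p (λ _ ())

coeff-scale₁-suc : ∀ q p m w → coeff (scale q 1 p) (suc m) w ≡ q ℚ.* coeff p m w
coeff-scale₁-suc q = coeff-map-image _ q ℕP.suc-injective (λ e → e) (λ _ → refl) (λ _ → refl) (λ _ → refl)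

coeff-pre-[] : ∀ a p m → coeff (pre a p) m [] ≡ 0ℚ
coeff-pre-[] a p m = coeff-map-outside _ p (λ _ ())

coeff-pre-≢ : ∀ {a b} p m w → ¬ a ≡ b → coeff (pre a p) m (b ∷ w) ≡ 0ℚ
coeff-pre-≢ p m w a≢b = coeff-map-outside _ p (λ _ (_ , e) → a≢b (LP.∷-injectiveˡ e))

coeff-pre-≡ : ∀ a p m w → coeff (pre a p) m (a ∷ w) ≡ coeff p m w
coeff-pre-≡ a p m w = trans (coeff-map-image _ 1ℚ (λ e → e) LP.∷-injectiveʳ (λ t → sym (ℚP.*-identityˡ (coef t))) (λ _ → refl) (λ _ → refl) p m w)
                            (ℚP.*-identityˡ (coeff p m w))

scale₀-cong : ∀ q {p p'} → p ≈ p' → scale q 0 p ≈ scale q 0 p'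
scale₀-cong q {p} {p'} e = mk≈ λ m w →
  trans (coeff-scale₀ q p m w) (trans (cong (q ℚ.*_) (coeff-≡ e m w)) (sym (coeff-scale₀ q p' m w)))

scale₁-cong : ∀ q {p p'} → p ≈ p' → scale q 1 p ≈ scale q 1 p'
scale₁-cong q {p} {p'} e = mk≈ λ where
  zero    w → trans (coeff-scale₁-zero q p w) (sym (coeff-scale₁-zero q p' w))
  (suc m) w → trans (coeff-scale₁-suc q p m w)
                (trans (cong (q ℚ.*_) (coeff-≡ e m w)) (sym (coeff-scale₁-suc q p' m w)))

pre-cong : ∀ a {p p'} → p ≈ p' → pre a p ≈ pre a p'
pre-cong a {p} {p'} e = mk≈ coeffs
  where
  coeffs : pre a p ≐ pre a p'
  coeffs m [] = trans (coeff-pre-[] a p m) (sym (coeff-pre-[] a p' m))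
  coeffs m (b ∷ w) with a ≟L b
  ... | yes refl = trans (coeff-pre-≡ a p m w) (trans (coeff-≡ e m w) (sym (coeff-pre-≡ a p' m w)))
  ... | no a≢b   = trans (coeff-pre-≢ p m w a≢b) (sym (coeff-pre-≢ p' m w a≢b))

neg-cong : ∀ {p p'} → p ≈ p' → neg p ≈ neg p'
neg-cong = scale₀-cong (ℚ.- 1ℚ)

·-cong : ∀ c {p p'} → p ≈ p' → c · p ≈ c · p'
·-cong c = scale₀-cong (toℚ c)

t·-cong : ∀ {p p'} → p ≈ p' → t· p ≈ t· p'
t·-cong = scale₁-cong 1ℚ

⊖-cong : ∀ {p p' q q'} → p ≈ p' → q ≈ q' → p ⊖ q ≈ p' ⊖ q'
⊖-cong p≈p' q≈q' = ⊕-cong p≈p' (neg-cong q≈q')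

·-distribʳ-+ : ∀ a b p → (a ℕ.+ b) · p ≈ a · p ⊕ b · p
·-distribʳ-+ a b p = mk≈ λ m w → begin
  coeff ((a ℕ.+ b) · p) m w                       ≡⟨ coeff-scale₀ (toℚ (a ℕ.+ b)) p m w ⟩
  toℚ (a ℕ.+ b) ℚ.* coeff p m w                   ≡⟨ cong (ℚ._* coeff p m w) (toℚ-+ a b) ⟩
  (toℚ a ℚ.+ toℚ b) ℚ.* coeff p m w               ≡⟨ ℚP.*-distribʳ-+ (coeff p m w) (toℚ a) (toℚ b) ⟩
  toℚ a ℚ.* coeff p m w ℚ.+ toℚ b ℚ.* coeff p m w ≡⟨ cong₂ ℚ._+_ (coeff-scale₀ (toℚ a) p m w) (coeff-scale₀ (toℚ b) p m w) ⟨
  coeff (a · p) m w ℚ.+ coeff (b · p) m w         ≡⟨ coeff-++ (a · p) (b · p) m w ⟨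
  coeff (a · p ⊕ b · p) m w                       ∎
  where open ≡-Reasoning

·-assoc : ∀ a b p → a · (b · p) ≈ (a ℕ.* b) · p
·-assoc a b p = mk≈ λ m w → begin
  coeff (a · (b · p)) m w                ≡⟨ coeff-scale₀ (toℚ a) (b · p) m w ⟩
  toℚ a ℚ.* coeff (b · p) m w            ≡⟨ cong (toℚ a ℚ.*_) (coeff-scale₀ (toℚ b) p m w) ⟩
  toℚ a ℚ.* (toℚ b ℚ.* coeff p m w)      ≡⟨ ℚP.*-assoc (toℚ a) (toℚ b) (coeff p m w) ⟨
  (toℚ a ℚ.* toℚ b) ℚ.* coeff p m w      ≡⟨ cong (ℚ._* coeff p m w) (toℚ-* a b) ⟨
  toℚ (a ℕ.* b) ℚ.* coeff p m w          ≡⟨ coeff-scale₀ (toℚ (a ℕ.* b)) p m w ⟨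
  coeff ((a ℕ.* b) · p) m w              ∎
  where open ≡-Reasoning

·-zeroˡ : ∀ p → 0 · p ≈ []
·-zeroˡ p = mk≈ λ m w → trans (coeff-scale₀ 0ℚ p m w) (ℚP.*-zeroˡ (coeff p m w))

·-identityˡ : ∀ p → 1 · p ≈ p
·-identityˡ p = mk≈ λ m w → trans (coeff-scale₀ 1ℚ p m w) (ℚP.*-identityˡ (coeff p m w))

·-vanish : ∀ {c} p → c ≡ 0 → c · p ≈ []
·-vanish p refl = ·-zeroˡ p

·-⊕ : ∀ c p q → c · (p ⊕ q) ≡ c · p ⊕ c · q
·-⊕ c p q = LP.map-++ _ p q

t·-⊕ : ∀ p q → t· (p ⊕ q) ≡ t· p ⊕ t· q
t·-⊕ p q = LP.map-++ _ p q

neg-⊕ : ∀ p q → neg (p ⊕ q) ≡ neg p ⊕ neg q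
neg-⊕ p q = LP.map-++ _ p q

scale-comm : ∀ q r d p → scale q 0 (scale r d p) ≡ scale r d (scale q 0 p)
scale-comm q r d [] = refl
scale-comm q r d (term c e u ∷ p) = cong₂ _∷_
  (cong (λ s → term s (d ℕ.+ e) u) (trans (sym (ℚP.*-assoc q r c)) (trans (cong (ℚ._* c) (ℚP.*-comm q r)) (ℚP.*-assoc r q c))))
  (scale-comm q r d p)

·-⊖-t· : ∀ c p q → c · (p ⊖ t· q) ≡ c · p ⊕ neg (t· (c · q))
·-⊖-t· c p q = trans (·-⊕ c p (neg (t· q)))
  (cong (c · p ⊕_) (trans (scale-comm (toℚ c) (ℚ.- 1ℚ) 0 (t· q)) (cong neg (scale-comm (toℚ c) 1ℚ 1 q))))

·-⟦⟧⊖t·⟦⟧-≡ : ∀ {c c' w₁ w₁' w₂ w₂'} → c ≡ c' → w₁ ≡ w₁' → w₂ ≡ w₂' →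
              c · (⟦ w₁ ⟧ ⊖ t· ⟦ w₂ ⟧) ≡ c' · (⟦ w₁' ⟧ ⊖ t· ⟦ w₂' ⟧)
·-⟦⟧⊖t·⟦⟧-≡ refl refl refl = refl

pre-scale : ∀ a q d p → pre a (scale q d p) ≡ scale q d (pre a p)
pre-scale a q d []      = refl
pre-scale a q d (t ∷ p) = cong (_ ∷_) (pre-scale a q d p)

pre-⊕ : ∀ a p q → pre a (p ⊕ q) ≡ pre a p ⊕ pre a q
pre-⊕ a p q = LP.map-++ _ p q

pre-⊖ : ∀ a p q → pre a (p ⊖ q) ≡ pre a p ⊖ pre a q
pre-⊖ a p q = trans (pre-⊕ a p (neg q)) (cong (pre a p ⊕_) (pre-scale a (ℚ.- 1ℚ) 0 q))

preWord : Word → Poly → Poly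
preWord u = map (λ t → term (coef t) (deg t) (u ++ word t))

preWord-[] : ∀ p → preWord [] p ≡ p
preWord-[] []      = refl
preWord-[] (t ∷ p) = cong (t ∷_) (preWord-[] p)

preWord-∷ : ∀ a u p → preWord (a ∷ u) p ≡ pre a (preWord u p)
preWord-∷ a u []      = refl
preWord-∷ a u (t ∷ p) = cong (_ ∷_) (preWord-∷ a u p)

preWord-cong : ∀ u {p p'} → p ≈ p' → preWord u p ≈ preWord u p'
preWord-cong [] {p} {p'} e = ≈-trans (≡⇒≈ (preWord-[] p)) (≈-trans e (≡⇒≈ (sym (preWord-[] p'))))
preWord-cong (a ∷ u) {p} {p'} e =
  ≈-trans (≡⇒≈ (preWord-∷ a u p)) (≈-trans (pre-cong a (preWord-cong u e)) (≡⇒≈ (sym (preWord-∷ a u p'))))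

preWord-⊕ : ∀ u p q → preWord u (p ⊕ q) ≡ preWord u p ⊕ preWord u q
preWord-⊕ u p q = LP.map-++ _ p q

preWord-scale : ∀ u q d p → preWord u (scale q d p) ≡ scale q d (preWord u p)
preWord-scale u q d []      = refl
preWord-scale u q d (t ∷ p) = cong (_ ∷_) (preWord-scale u q d p)

⨁ : ℕ → (ℕ → Poly) → Poly
⨁ zero    f = []
⨁ (suc n) f = f 0 ⊕ ⨁ n (f ∘ suc)

infix 10 ⨁
syntax ⨁ n (λ i → e) = ⨁[ i < n ] e

Σ-list-upTo : ∀ n f → Σ-list (upTo n) f ≡ ⨁ n f
Σ-list-upTo n f = go n (λ i → i)
  where
  go : ∀ n g → Σ-list (L.applyUpTo g n) f ≡ ⨁ n (f ∘ g)
  go zero    g = refl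
  go (suc n) g = cong (f (g 0) ⊕_) (go n (g ∘ suc))

⨁-cong-< : ∀ n {f g} → (∀ i → i < n → f i ≈ g i) → ⨁ n f ≈ ⨁ n g
⨁-cong-< zero    e = ≈-refl
⨁-cong-< (suc n) e = ⊕-cong (e 0 (s≤s z≤n)) (⨁-cong-< n (λ i i<n → e (suc i) (s≤s i<n)))

⨁-cong≡ : ∀ n {f g} → (∀ i → f i ≡ g i) → ⨁ n f ≡ ⨁ n g
⨁-cong≡ zero    e = refl
⨁-cong≡ (suc n) e = cong₂ _⊕_ (e 0) (⨁-cong≡ n (e ∘ suc))

⨁-cong : ∀ n {f g} → (∀ i → f i ≈ g i) → ⨁ n f ≈ ⨁ n g
⨁-cong n e = ⨁-cong-< n (λ i _ → e i)

⨁-vanish : ∀ n {f} → (∀ i → i < n → f i ≈ []) → ⨁ n f ≈ []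
⨁-vanish zero    e = ≈-refl
⨁-vanish (suc n) e = ⊕-cong (e 0 (s≤s z≤n)) (⨁-vanish n (λ i i<n → e (suc i) (s≤s i<n)))

⨁-⊕ : ∀ n f g → ⨁[ i < n ] (f i ⊕ g i) ≈ ⨁ n f ⊕ ⨁ n g
⨁-⊕ zero    f g = ≈-refl
⨁-⊕ (suc n) f g = ≈-trans (⊕-cong ≈-refl (⨁-⊕ n (f ∘ suc) (g ∘ suc)))
  (solve 4 (λ a b c d → (a ⊞ b) ⊞ (c ⊞ d) ⊜ (a ⊞ c) ⊞ (b ⊞ d)) ≈-refl (f 0) (g 0) (⨁ n (f ∘ suc)) (⨁ n (g ∘ suc)))

⨁-+ : ∀ m n f → ⨁ (m ℕ.+ n) f ≡ ⨁ m f ⊕ (⨁[ i < n ] f (m ℕ.+ i))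
⨁-+ zero    n f = refl
⨁-+ (suc m) n f = trans (cong (f 0 ⊕_) (⨁-+ m n (f ∘ suc))) (sym (LP.++-assoc (f 0) _ _))

⨁-+-vanishˡ : ∀ m n f → (∀ i → i < m → f i ≈ []) → ⨁ (m ℕ.+ n) f ≈ ⨁[ i < n ] f (m ℕ.+ i)
⨁-+-vanishˡ m n f e = ≈-trans (≡⇒≈ (⨁-+ m n f)) (⊕-cong (⨁-vanish m e) ≈-refl)

⨁-+-vanishʳ : ∀ m n f → (∀ i → i < n → f (m ℕ.+ i) ≈ []) → ⨁ (m ℕ.+ n) f ≈ ⨁ m f
⨁-+-vanishʳ m n f e = ≈-trans (≡⇒≈ (⨁-+ m n f)) (≈-trans (⊕-cong ≈-refl (⨁-vanish n e)) (⊕-identityʳ _))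

map-⨁ : ∀ (h : Term → Term) n f → map h (⨁ n f) ≡ ⨁[ i < n ] map h (f i)
map-⨁ h zero    f = refl
map-⨁ h (suc n) f = trans (LP.map-++ h (f 0) _) (cong (map h (f 0) ⊕_) (map-⨁ h n (f ∘ suc)))

pre-⨁ : ∀ a n f → pre a (⨁ n f) ≡ ⨁[ i < n ] pre a (f i)
pre-⨁ a = map-⨁ _

⨁-⊖-t· : ∀ n f g → ⨁[ i < n ] (f i ⊕ neg (t· g i)) ≈ ⨁ n f ⊖ t· ⨁ n g
⨁-⊖-t· n f g = ≈-trans (⨁-⊕ n f (λ i → neg (t· g i)))
  (≡⇒≈ (cong (⨁ n f ⊕_) (sym (trans (cong neg (map-⨁ _ n g)) (map-⨁ _ n (λ i → t· g i))))))

⨁-comm : ∀ n m (f : ℕ → ℕ → Poly) → ⨁[ i < n ] ⨁[ j < m ] f i j ≈ ⨁[ j < m ] ⨁[ i < n ] f i j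
⨁-comm zero    m f = ≈-sym (⨁-vanish m {λ _ → []} (λ _ _ → ≈-refl))
⨁-comm (suc n) m f = ≈-trans (⊕-cong (≈-refl {⨁ m (f 0)}) (⨁-comm n m (f ∘ suc)))
  (≈-sym (⨁-⊕ m (f 0) (λ j → ⨁[ i < n ] f (suc i) j)))

⨁-snoc : ∀ n f → ⨁ (suc n) f ≈ ⨁ n f ⊕ f n
⨁-snoc zero    f = ⊕-identityʳ (f 0)
⨁-snoc (suc n) f = ≈-trans (⊕-cong (≈-refl {f 0}) (⨁-snoc n (f ∘ suc))) (≈-sym (⊕-assoc (f 0) _ _))

Σ-list-vanish : ∀ {A : Set} (xs : List A) {f : A → Poly} → (∀ a → f a ≈ []) → Σ-list xs f ≈ []
Σ-list-vanish []       e = ≈-refl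
Σ-list-vanish (a ∷ xs) e = ⊕-cong (e a) (Σ-list-vanish xs e)

when : ∀ {A : Set} → Dec A → Poly → Poly
when (true  because _) p = p
when (false because _) p = []

when-⇔ : ∀ {A B : Set} (A? : Dec A) (B? : Dec B) p → (A → B) → (B → A) → when A? p ≡ when B? p
when-⇔ (true  because _) (true  because _) p A→B B→A = refl
when-⇔ (false because _) (false because _) p A→B B→A = refl
when-⇔ (yes a) (no ¬b) p A→B B→A = ⊥-elim (¬b (A→B a))
when-⇔ (no ¬a) (yes b) p A→B B→A = ⊥-elim (¬a (B→A b))

when-no : ∀ {A : Set} (A? : Dec A) p → ¬ A → when A? p ≡ []
when-no (yes a) p ¬a = ⊥-elim (¬a a)
when-no (no _)  p ¬a = refl

Σ-list-filter : ∀ {A : Set} {P : Pred A 0ℓ} (P? : Decidable P) xs (f : A → Poly) →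
                Σ-list (filter P? xs) f ≡ Σ-list xs (λ a → when (P? a) (f a))
Σ-list-filter P? []       f = refl
Σ-list-filter P? (a ∷ xs) f with P? a
... | true  because _ = cong (f a ⊕_) (Σ-list-filter P? xs f)
... | false because _ = Σ-list-filter P? xs f

Σ-list-concatMap : ∀ {A B : Set} (g : A → List B) xs (f : B → Poly) →
                   Σ-list (L.concatMap g xs) f ≡ Σ-list xs (λ a → Σ-list (g a) f)
Σ-list-concatMap g []       f = refl
Σ-list-concatMap g (a ∷ xs) f =
  trans (LP.concatMap-++ f (g a) (L.concatMap g xs)) (cong (Σ-list (g a) f ⊕_) (Σ-list-concatMap g xs f))

Σ-list-lists-suc : ∀ p N (f : List ℕ → Poly) →
                   Σ-list (lists (suc p) N) f ≡ ⨁[ a < N ] Σ-list (lists p N) (f ∘ (suc a ∷_))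
Σ-list-lists-suc p N f = begin
  Σ-list (L.concatMap extend (map suc (upTo N))) f
    ≡⟨ Σ-list-concatMap extend (map suc (upTo N)) f ⟩
  Σ-list (map suc (upTo N)) (λ a → Σ-list (extend a) f)
    ≡⟨ LP.concatMap-map (λ a → Σ-list (extend a) f) suc (upTo N) ⟩
  Σ-list (upTo N) (λ a → Σ-list (extend (suc a)) f)
    ≡⟨ LP.concatMap-cong (λ a → LP.concatMap-map f (suc a ∷_) (lists p N)) (upTo N) ⟩
  Σ-list (upTo N) (λ a → Σ-list (lists p N) (f ∘ (suc a ∷_)))
    ≡⟨ Σ-list-upTo N _ ⟩
  ⨁[ a < N ] Σ-list (lists p N) (f ∘ (suc a ∷_)) ∎
  where
  open ≡-Reasoning
  extend : ℕ → List (List ℕ)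
  extend a = map (a ∷_) (lists p N)

Σcomp : ℕ → ℕ → (List ℕ → Poly) → Poly
Σcomp zero    zero    f = f []
Σcomp zero    (suc _) f = []
Σcomp (suc p) M       f = ⨁[ a < M ] Σcomp p (M ∸ suc a) (f ∘ (suc a ∷_))

Σ-bounded : ℕ → ℕ → ℕ → (List ℕ → Poly) → Poly
Σ-bounded p K M f = Σ-list (lists p K) (λ β → when (sum β ℕ.≟ M) (f β))

Σ-bounded≈Σcomp : ∀ p K M f → M ≤ K → Σ-bounded p K M f ≈ Σcomp p M f
Σ-bounded≈Σcomp zero K zero    f M≤K = ⊕-identityʳ (f [])
Σ-bounded≈Σcomp zero K (suc M) f M≤K = ≈-refl
Σ-bounded≈Σcomp (suc p) K M f M≤K = begin
  Σ-bounded (suc p) K M f               ≡⟨ Σ-list-lists-suc p K _ ⟩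
  ⨁ K summand                           ≡⟨ cong (λ n → ⨁ n summand) (ℕP.m+[n∸m]≡n M≤K) ⟨
  ⨁ (M ℕ.+ (K ∸ M)) summand             ≈⟨ ⨁-+-vanishʳ M (K ∸ M) summand (λ i _ → Σ-list-vanish (lists p K) (too-big i)) ⟩
  ⨁ M summand                           ≈⟨ ⨁-cong-< M first ⟩
  Σcomp (suc p) M f                     ∎
  where
  open ≈-Reasoning
  summand : ℕ → Poly
  summand a = Σ-list (lists p K) (λ β → when (suc a ℕ.+ sum β ℕ.≟ M) (f (suc a ∷ β)))
  first : ∀ a → a < M → summand a ≈ Σcomp p (M ∸ suc a) (f ∘ (suc a ∷_))
  first a a<M = ≈-trans
    (≡⇒≈ (LP.concatMap-cong (λ β → when-⇔ (suc a ℕ.+ sum β ℕ.≟ M) (sum β ℕ.≟ M ∸ suc a) (f (suc a ∷ β))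
            (λ e → trans (sym (ℕP.m+n∸m≡n (suc a) (sum β))) (cong (_∸ suc a) e))
            (λ e → trans (cong (suc a ℕ.+_) e) (ℕP.m+[n∸m]≡n a<M))) (lists p K)))
    (Σ-bounded≈Σcomp p K (M ∸ suc a) (f ∘ (suc a ∷_)) (ℕP.≤-trans (ℕP.m∸n≤m M (suc a)) M≤K))
  too-big : ∀ i β → when (suc (M ℕ.+ i) ℕ.+ sum β ℕ.≟ M) (f (suc (M ℕ.+ i) ∷ β)) ≈ []
  too-big i β = ≡⇒≈ (when-no (suc (M ℕ.+ i) ℕ.+ sum β ℕ.≟ M) _
    (λ e → ℕP.<-irrefl (sym e) (s≤s (ℕP.≤-trans (ℕP.m≤m+n M i) (ℕP.m≤m+n (M ℕ.+ i) (sum β))))))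

Σ-compositions : ∀ p N f → Σ-list (compositions p N) f ≈ Σcomp p N f
Σ-compositions p N f =
  ≈-trans (≡⇒≈ (Σ-list-filter (λ α → sum α ℕ.≟ N) (lists p N) f)) (Σ-bounded≈Σcomp p N N f ℕP.≤-refl)

Σcomp-cong : ∀ p M {f g} → (∀ α → f α ≈ g α) → Σcomp p M f ≈ Σcomp p M g
Σcomp-cong zero    zero    e = e []
Σcomp-cong zero    (suc M) e = ≈-refl
Σcomp-cong (suc p) M       e = ⨁-cong M (λ a → Σcomp-cong p (M ∸ suc a) (e ∘ (suc a ∷_)))

map-Σcomp : ∀ (h : Term → Term) p M f → map h (Σcomp p M f) ≡ Σcomp p M (map h ∘ f)
map-Σcomp h zero    zero    f = refl
map-Σcomp h zero    (suc M) f = refl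
map-Σcomp h (suc p) M       f =
  trans (map-⨁ h M _) (⨁-cong≡ M (λ a → map-Σcomp h p (M ∸ suc a) (f ∘ (suc a ∷_))))

Σcomp-1 : ∀ n f → Σcomp 1 (suc n) f ≈ f (suc n ∷ [])
Σcomp-1 n f = ≈-trans (⨁-snoc n (λ a → Σcomp 0 (n ∸ a) (f ∘ (suc a ∷_)))) (⊕-cong (⨁-vanish n too-short) last)
  where
  too-short : ∀ a → a < n → Σcomp 0 (n ∸ a) (f ∘ (suc a ∷_)) ≈ []
  too-short a a<n = ≡⇒≈ (cong (λ m → Σcomp 0 m (f ∘ (suc a ∷_))) (∸-suc a<n))
  last : Σcomp 0 (n ∸ n) (f ∘ (suc n ∷_)) ≈ f (suc n ∷ [])
  last = ≡⇒≈ (cong (λ m → Σcomp 0 m (f ∘ (suc n ∷_))) (ℕP.n∸n≡0 n))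

Σcomp-2 : ∀ n f → Σcomp 2 (suc (suc n)) f ≈ ⨁[ a < suc n ] f (suc a ∷ suc (n ∸ a) ∷ [])
Σcomp-2 n f = ≈-trans (⨁-snoc (suc n) (λ a → Σcomp 1 (suc n ∸ a) (f ∘ (suc a ∷_))))
  (≈-trans (⊕-cong (⨁-cong-< (suc n) pair) last) (⊕-identityʳ _))
  where
  pair : ∀ a → a < suc n → Σcomp 1 (suc n ∸ a) (f ∘ (suc a ∷_)) ≈ f (suc a ∷ suc (n ∸ a) ∷ [])
  pair a (s≤s a≤n) = ≈-trans (≡⇒≈ (cong (λ m → Σcomp 1 m (f ∘ (suc a ∷_))) (ℕP.+-∸-assoc 1 a≤n)))
                             (Σcomp-1 (n ∸ a) (f ∘ (suc a ∷_)))
  last : Σcomp 1 (suc n ∸ suc n) (f ∘ (suc (suc n) ∷_)) ≈ []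
  last = ≡⇒≈ (cong (λ m → Σcomp 1 m (f ∘ (suc (suc n) ∷_))) (ℕP.n∸n≡0 n))

-- The shuffle of two blocks

-- z_a z_b W − t z_c W, with c (always a + b) a separate argument so that prefixing x acts definitionally.
pairTerm : ℕ → ℕ → ℕ → Word → Poly
pairTerm a b c W = ⟦ z a ++ z b ++ W ⟧ ⊖ t· ⟦ z c ++ W ⟧

-- The terms of z_{p+1} ⧢ z_{q+1} W whose first y comes from z_{p+1} (leftFirst) or from z_{q+1} (rightFirst).
leftFirst : ℕ → ℕ → Word → Poly
leftFirst p q W = ⨁[ j < suc q ] ((p ℕ.+ j) C p) · pairTerm (suc (p ℕ.+ j)) (suc (q ∸ j)) (suc (suc (p ℕ.+ q))) W

rightFirst : ℕ → ℕ → Word → Poly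
rightFirst p q W = ⨁[ i < suc p ] ((q ℕ.+ i) C q) · preWord (z (suc (q ℕ.+ i))) (z (suc (p ∸ i)) ⧢ W)

emptyCorrection : ℕ → ℕ → Word → Poly
emptyCorrection p q []      = t· (⨁[ i < suc p ] ((q ℕ.+ i) C q) · ⟦ z (suc (suc (q ℕ.+ p))) ⟧)
emptyCorrection p q (_ ∷ _) = []

blockShuffle : ℕ → ℕ → Word → Poly
blockShuffle p q W = (leftFirst p q W ⊕ rightFirst p q W) ⊖ emptyCorrection p q W

⨁-pascal : ∀ n a (g : ℕ → Poly) →
  ⨁[ j < suc (suc n) ] ((suc a ℕ.+ j) C suc a) · g j ≈
  (⨁[ j < suc (suc n) ] ((a ℕ.+ j) C a) · g j) ⊕ (⨁[ j < suc n ] ((suc a ℕ.+ j) C suc a) · g (suc j))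
⨁-pascal n a g = begin
  ⨁[ j < suc (suc n) ] ((suc a ℕ.+ j) C suc a) · g j
    ≈⟨ ⊕-cong (≡⇒≈ first) (⨁-cong (suc n) pascal) ⟩
  F 0 ⊕ (⨁[ j < suc n ] (F (suc j) ⊕ G j))
    ≈⟨ ⊕-cong (≈-refl {F 0}) (⨁-⊕ (suc n) (F ∘ suc) G) ⟩
  F 0 ⊕ (⨁ (suc n) (F ∘ suc) ⊕ ⨁ (suc n) G)
    ≈⟨ ⊕-assoc (F 0) _ _ ⟨
  ⨁ (suc (suc n)) F ⊕ ⨁ (suc n) G ∎
  where
  open ≈-Reasoning
  F G : ℕ → Poly
  F j = ((a ℕ.+ j) C a) · g j
  G j = ((suc a ℕ.+ j) C suc a) · g (suc j)
  first : ((suc a ℕ.+ 0) C suc a) · g 0 ≡ F 0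
  first = cong (_· g 0) (trans ([n+0]Cn≡1 (suc a)) (sym ([n+0]Cn≡1 a)))
  pascal : ∀ j → ((suc a ℕ.+ suc j) C suc a) · g (suc j) ≈ F (suc j) ⊕ G j
  pascal j = ≈-trans (≡⇒≈ (cong (_· g (suc j)) (sym (nCk+nC[k+1]≡[n+1]C[k+1] (a ℕ.+ suc j) a))))
    (≈-trans (·-distribʳ-+ ((a ℕ.+ suc j) C a) ((a ℕ.+ suc j) C suc a) (g (suc j)))
      (⊕-cong (≈-refl {F (suc j)}) (≡⇒≈ (cong (λ m → (m C suc a) · g (suc j)) (ℕP.+-suc a j)))))

pre-x-·-preWord : ∀ c m p → pre x (c · preWord (z (suc m)) p) ≡ c · preWord (z (suc (suc m))) p
pre-x-·-preWord c m p = trans (pre-scale x (toℚ c) 0 (preWord (z (suc m)) p)) (cong (c ·_) (sym (preWord-∷ x (z (suc m)) p)))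

leftFirst-zero-suc : ∀ q W → leftFirst 0 (suc q) W ≈ pairTerm 1 (suc (suc q)) (suc (suc (suc q))) W ⊕ pre x (leftFirst 0 q W)
leftFirst-zero-suc q W = ⊕-cong (·-identityˡ (pairTerm 1 (suc (suc q)) (suc (suc (suc q))) W))
  (≡⇒≈ (sym (pre-⨁ x (suc q) (λ j → (j C 0) · pairTerm (suc j) (suc (q ∸ j)) (suc (suc q)) W))))

rightFirst-zero-suc : ∀ q W → rightFirst 0 (suc q) W ≈ pre x (rightFirst 0 q W)
rightFirst-zero-suc q W = ≡⇒≈ (begin
  ((suc q ℕ.+ 0) C suc q) · preWord (z (suc (suc q ℕ.+ 0))) (z 1 ⧢ W) ⊕ []
    ≡⟨ cong (λ c → c · preWord (z (suc (suc q ℕ.+ 0))) (z 1 ⧢ W) ⊕ []) (trans ([n+0]Cn≡1 (suc q)) (sym ([n+0]Cn≡1 q))) ⟩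
  ((q ℕ.+ 0) C q) · preWord (z (suc (suc q ℕ.+ 0))) (z 1 ⧢ W) ⊕ []
    ≡⟨ cong (_⊕ []) (pre-x-·-preWord ((q ℕ.+ 0) C q) (q ℕ.+ 0) (z 1 ⧢ W)) ⟨
  pre x (((q ℕ.+ 0) C q) · preWord (z (suc (q ℕ.+ 0))) (z 1 ⧢ W)) ⊕ []
    ≡⟨ pre-⊕ x _ [] ⟨
  pre x (rightFirst 0 q W) ∎)
  where open ≡-Reasoning

emptyCorrection-zero-suc : ∀ q W → emptyCorrection 0 (suc q) W ≈ pre x (emptyCorrection 0 q W)
emptyCorrection-zero-suc q []      =
  ≡⇒≈ (cong (λ c → t· (c · ⟦ z (suc (suc (suc q ℕ.+ 0))) ⟧ ⊕ [])) (trans ([n+0]Cn≡1 (suc q)) (sym ([n+0]Cn≡1 q))))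
emptyCorrection-zero-suc q (_ ∷ _) = ≈-refl

leftFirst-suc-zero : ∀ p W → leftFirst (suc p) 0 W ≈ pre x (leftFirst p 0 W)
leftFirst-suc-zero p W =
  ≡⇒≈ (cong (λ c → c · pairTerm (suc (suc p ℕ.+ 0)) 1 (suc (suc (suc p ℕ.+ 0))) W ⊕ []) (trans ([n+0]Cn≡1 (suc p)) (sym ([n+0]Cn≡1 p))))

rightFirst-suc-zero : ∀ p W → rightFirst (suc p) 0 W ≈ pre y (z (suc (suc p)) ⧢ W) ⊕ pre x (rightFirst p 0 W)
rightFirst-suc-zero p W = ⊕-cong (·-identityˡ (preWord (y ∷ []) (z (suc (suc p)) ⧢ W)))
  (≈-trans (⨁-cong (suc p) shift) (≡⇒≈ (sym (pre-⨁ x (suc p) summand))))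
  where
  summand : ℕ → Poly
  summand i = (i C 0) · preWord (z (suc i)) (z (suc (p ∸ i)) ⧢ W)
  shift : ∀ i → (suc i C 0) · preWord (z (suc (suc i))) (z (suc (p ∸ i)) ⧢ W) ≈ pre x (summand i)
  shift i = ≡⇒≈ (sym (pre-x-·-preWord 1 i (z (suc (p ∸ i)) ⧢ W)))

emptyCorrection-suc-zero : ∀ p W → emptyCorrection (suc p) 0 W ≈ δρ W y (z (suc (suc p))) ⊕ pre x (emptyCorrection p 0 W)
emptyCorrection-suc-zero p []      =
  ≈-trans (≡⇒≈ (t·-⊕ (1 · w) (⨁[ i < suc p ] (suc i C 0) · w))) (⊕-cong (t·-cong (·-identityˡ w)) (≡⇒≈ tail))
  where
  w : Poly
  w = ⟦ z (suc (suc (suc p))) ⟧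
  summand : ℕ → Poly
  summand i = (i C 0) · ⟦ z (suc (suc p)) ⟧
  tail : t· (⨁[ i < suc p ] (suc i C 0) · w) ≡ pre x (t· (⨁ (suc p) summand))
  tail = trans (cong t·_ (sym (pre-⨁ x (suc p) summand))) (sym (pre-scale x 1ℚ 1 (⨁ (suc p) summand)))
emptyCorrection-suc-zero p (_ ∷ _) = ≈-refl

leftFirst-suc-suc : ∀ p q W → leftFirst (suc p) (suc q) W ≈ pre x (leftFirst p (suc q) W) ⊕ pre x (leftFirst (suc p) q W)
leftFirst-suc-suc p q W = ≈-trans (⨁-pascal q p g)
  (⊕-cong (≡⇒≈ (sym (pre-⨁ x (suc (suc q)) left)))
          (≈-trans (⨁-cong (suc q) (λ j → ≡⇒≈ (cong (((suc p ℕ.+ j) C suc p) ·_) (reindex j))))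
                   (≡⇒≈ (sym (pre-⨁ x (suc q) right)))))
  where
  g left right : ℕ → Poly
  g j     = pairTerm (suc (suc (p ℕ.+ j))) (suc (suc q ∸ j)) (suc (suc (suc (p ℕ.+ suc q)))) W
  left j  = ((p ℕ.+ j) C p) · pairTerm (suc (p ℕ.+ j)) (suc (suc q ∸ j)) (suc (suc (p ℕ.+ suc q))) W
  right j = ((suc p ℕ.+ j) C suc p) · pairTerm (suc (suc p ℕ.+ j)) (suc (q ∸ j)) (suc (suc (suc p ℕ.+ q))) W
  reindex : ∀ j → g (suc j) ≡ pairTerm (suc (suc (suc p ℕ.+ j))) (suc (q ∸ j)) (suc (suc (suc (suc p ℕ.+ q)))) W
  reindex j = cong₂ (λ a c → pairTerm (suc (suc a)) (suc (q ∸ j)) (suc (suc (suc c))) W) (ℕP.+-suc p j) (ℕP.+-suc p q)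

rightFirst-suc-suc : ∀ p q W → rightFirst (suc p) (suc q) W ≈ pre x (rightFirst p (suc q) W) ⊕ pre x (rightFirst (suc p) q W)
rightFirst-suc-suc p q W = ≈-trans (⨁-pascal p q g)
  (≈-trans (⊕-comm (⨁[ i < suc (suc p) ] ((q ℕ.+ i) C q) · g i) (⨁[ i < suc p ] ((suc q ℕ.+ i) C suc q) · g (suc i)))
    (⊕-cong (≈-trans (⨁-cong (suc p) left-shift) (≡⇒≈ (sym (pre-⨁ x (suc p) left))))
            (≈-trans (⨁-cong (suc (suc p)) right-shift) (≡⇒≈ (sym (pre-⨁ x (suc (suc p)) right))))))
  where
  g left right : ℕ → Poly
  g i     = preWord (z (suc (suc q ℕ.+ i))) (z (suc (suc p ∸ i)) ⧢ W)
  left i  = ((suc q ℕ.+ i) C suc q) · preWord (z (suc (suc q ℕ.+ i))) (z (suc (p ∸ i)) ⧢ W)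
  right i = ((q ℕ.+ i) C q) · preWord (z (suc (q ℕ.+ i))) (z (suc (suc p ∸ i)) ⧢ W)
  left-shift : ∀ i → ((suc q ℕ.+ i) C suc q) · g (suc i) ≈ pre x (left i)
  left-shift i = ≡⇒≈ (trans (cong (λ m → ((suc q ℕ.+ i) C suc q) · preWord (z (suc (suc m))) (z (suc (p ∸ i)) ⧢ W)) (ℕP.+-suc q i))
                            (sym (pre-x-·-preWord ((suc q ℕ.+ i) C suc q) (suc (q ℕ.+ i)) (z (suc (p ∸ i)) ⧢ W))))
  right-shift : ∀ i → ((q ℕ.+ i) C q) · g i ≈ pre x (right i)
  right-shift i = ≡⇒≈ (sym (pre-x-·-preWord ((q ℕ.+ i) C q) (q ℕ.+ i) (z (suc (suc p ∸ i)) ⧢ W)))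

emptyCorrection-suc-suc : ∀ p q W →
  emptyCorrection (suc p) (suc q) W ≈ pre x (emptyCorrection p (suc q) W) ⊕ pre x (emptyCorrection (suc p) q W)
emptyCorrection-suc-suc p q [] = ≈-trans (t·-cong (⨁-pascal p q (λ _ → w)))
  (≈-trans (≡⇒≈ (t·-⊕ below above)) (≈-trans (⊕-comm (t· below) (t· above))
    (⊕-cong (≡⇒≈ (trans (cong (λ m → t· (⨁[ i < suc p ] ((suc q ℕ.+ i) C suc q) · ⟦ z (suc (suc (suc m))) ⟧)) (ℕP.+-suc q p))
                        (pre-x-t·-⨁ (suc p) (λ i → (suc q ℕ.+ i) C suc q) (suc (suc q ℕ.+ p)))))
            (≡⇒≈ (pre-x-t·-⨁ (suc (suc p)) (λ i → (q ℕ.+ i) C q) (suc (q ℕ.+ suc p)))))))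
  where
  w below above : Poly
  w     = ⟦ z (suc (suc (suc q ℕ.+ suc p))) ⟧
  below = ⨁[ i < suc (suc p) ] ((q ℕ.+ i) C q) · w
  above = ⨁[ i < suc p ] ((suc q ℕ.+ i) C suc q) · w
  pre-x-t·-⨁ : ∀ n (c : ℕ → ℕ) m → t· (⨁[ i < n ] c i · ⟦ z (suc (suc m)) ⟧) ≡ pre x (t· (⨁[ i < n ] c i · ⟦ z (suc m) ⟧))
  pre-x-t·-⨁ n c m = trans (cong t·_ (sym (pre-⨁ x n (λ i → c i · ⟦ z (suc m) ⟧)))) (sym (pre-scale x 1ℚ 1 _))
emptyCorrection-suc-suc p q (_ ∷ _) = ≈-refl

⊖-interchange : ∀ a b c d → ((a ⊕ b) ⊖ c) ⊖ d ≈ (a ⊖ c) ⊕ (b ⊖ d)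
⊖-interchange a b c d =
  solve 4 (λ a b c d → ((a ⊞ b) ⊞ c) ⊞ d ⊜ (a ⊞ c) ⊞ (b ⊞ d)) ≈-refl a b (neg c) (neg d)

⊖-δρ-x : ∀ p w v → p ⊖ δρ w x v ≈ p
⊖-δρ-x p []      v = ⊕-identityʳ p
⊖-δρ-x p (_ ∷ _) v = ⊕-identityʳ p

pre-⊕⊖ : ∀ a L R E → pre a ((L ⊕ R) ⊖ E) ≡ (pre a L ⊕ pre a R) ⊖ pre a E
pre-⊕⊖ a L R E = trans (pre-⊖ a (L ⊕ R) E) (cong (_⊖ pre a E) (pre-⊕ a L R))

blockShuffle-zero-zero : ∀ W → blockShuffle 0 0 W ≈ pairTerm 1 1 2 W ⊕ (pre y (z 1 ⧢ W) ⊖ δρ W y (z 1))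
blockShuffle-zero-zero W = begin
  (leftFirst 0 0 W ⊕ rightFirst 0 0 W) ⊖ emptyCorrection 0 0 W
    ≈⟨ ⊖-cong (⊕-cong (single (pairTerm 1 1 2 W)) (single (preWord (y ∷ []) (z 1 ⧢ W)))) (correction W) ⟩
  (pairTerm 1 1 2 W ⊕ preWord (y ∷ []) (z 1 ⧢ W)) ⊖ δρ W y (z 1)
    ≡⟨ cong (λ p → (pairTerm 1 1 2 W ⊕ p) ⊖ δρ W y (z 1)) (preWord-∷ y [] (z 1 ⧢ W)) ⟩
  (pairTerm 1 1 2 W ⊕ pre y (preWord [] (z 1 ⧢ W))) ⊖ δρ W y (z 1)
    ≡⟨ cong (λ p → (pairTerm 1 1 2 W ⊕ pre y p) ⊖ δρ W y (z 1)) (preWord-[] (z 1 ⧢ W)) ⟩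
  (pairTerm 1 1 2 W ⊕ pre y (z 1 ⧢ W)) ⊖ δρ W y (z 1)
    ≈⟨ ⊕-assoc (pairTerm 1 1 2 W) (pre y (z 1 ⧢ W)) (neg (δρ W y (z 1))) ⟩
  pairTerm 1 1 2 W ⊕ (pre y (z 1 ⧢ W) ⊖ δρ W y (z 1)) ∎
  where
  open ≈-Reasoning
  single : ∀ p → 1 · p ⊕ [] ≈ p
  single p = ≈-trans (⊕-identityʳ (1 · p)) (·-identityˡ p)
  correction : ∀ W → emptyCorrection 0 0 W ≈ δρ W y (z 1)
  correction []      = t·-cong (single ⟦ x ∷ y ∷ [] ⟧)
  correction (_ ∷ _) = ≈-refl

blockShuffle-zero-suc : ∀ q W → blockShuffle 0 (suc q) W ≈ pairTerm 1 (suc (suc q)) (suc (suc (suc q))) W ⊕ pre x (blockShuffle 0 q W)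
blockShuffle-zero-suc q W = begin
  (leftFirst 0 (suc q) W ⊕ rightFirst 0 (suc q) W) ⊖ emptyCorrection 0 (suc q) W
    ≈⟨ ⊖-cong (⊕-cong (leftFirst-zero-suc q W) (rightFirst-zero-suc q W)) (emptyCorrection-zero-suc q W) ⟩
  ((P ⊕ pre x L) ⊕ pre x R) ⊖ pre x E
    ≈⟨ solve 4 (λ p l r e → ((p ⊞ l) ⊞ r) ⊞ e ⊜ p ⊞ ((l ⊞ r) ⊞ e)) ≈-refl P (pre x L) (pre x R) (neg (pre x E)) ⟩
  P ⊕ ((pre x L ⊕ pre x R) ⊖ pre x E)
    ≡⟨ cong (P ⊕_) (pre-⊕⊖ x L R E) ⟨
  P ⊕ pre x (blockShuffle 0 q W) ∎
  where
  open ≈-Reasoning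
  P L R E : Poly
  P = pairTerm 1 (suc (suc q)) (suc (suc (suc q))) W
  L = leftFirst 0 q W
  R = rightFirst 0 q W
  E = emptyCorrection 0 q W

blockShuffle-suc-zero : ∀ p W →
  blockShuffle (suc p) 0 W ≈ pre x (blockShuffle p 0 W) ⊕ (pre y (z (suc (suc p)) ⧢ W) ⊖ δρ W y (z (suc (suc p))))
blockShuffle-suc-zero p W = begin
  (leftFirst (suc p) 0 W ⊕ rightFirst (suc p) 0 W) ⊖ emptyCorrection (suc p) 0 W
    ≈⟨ ⊖-cong (⊕-cong (leftFirst-suc-zero p W) (rightFirst-suc-zero p W)) (emptyCorrection-suc-zero p W) ⟩
  (pre x L ⊕ (Y ⊕ pre x R)) ⊖ (D ⊕ pre x E)
    ≡⟨ cong ((pre x L ⊕ (Y ⊕ pre x R)) ⊕_) (neg-⊕ D (pre x E)) ⟩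
  (pre x L ⊕ (Y ⊕ pre x R)) ⊕ (neg D ⊕ neg (pre x E))
    ≈⟨ solve 5 (λ l y r d e → (l ⊞ (y ⊞ r)) ⊞ (d ⊞ e) ⊜ ((l ⊞ r) ⊞ e) ⊞ (y ⊞ d)) ≈-refl
               (pre x L) Y (pre x R) (neg D) (neg (pre x E)) ⟩
  ((pre x L ⊕ pre x R) ⊖ pre x E) ⊕ (Y ⊖ D)
    ≡⟨ cong (_⊕ (Y ⊖ D)) (pre-⊕⊖ x L R E) ⟨
  pre x (blockShuffle p 0 W) ⊕ (Y ⊖ D) ∎
  where
  open ≈-Reasoning
  Y D L R E : Poly
  Y = pre y (z (suc (suc p)) ⧢ W)
  D = δρ W y (z (suc (suc p)))
  L = leftFirst p 0 W
  R = rightFirst p 0 W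
  E = emptyCorrection p 0 W

blockShuffle-suc-suc : ∀ p q W →
  blockShuffle (suc p) (suc q) W ≈ pre x (blockShuffle p (suc q) W) ⊕ pre x (blockShuffle (suc p) q W)
blockShuffle-suc-suc p q W = begin
  (leftFirst (suc p) (suc q) W ⊕ rightFirst (suc p) (suc q) W) ⊖ emptyCorrection (suc p) (suc q) W
    ≈⟨ ⊖-cong (⊕-cong (leftFirst-suc-suc p q W) (rightFirst-suc-suc p q W)) (emptyCorrection-suc-suc p q W) ⟩
  ((pre x L₁ ⊕ pre x L₂) ⊕ (pre x R₁ ⊕ pre x R₂)) ⊖ (pre x E₁ ⊕ pre x E₂)
    ≡⟨ cong (((pre x L₁ ⊕ pre x L₂) ⊕ (pre x R₁ ⊕ pre x R₂)) ⊕_) (neg-⊕ (pre x E₁) (pre x E₂)) ⟩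
  ((pre x L₁ ⊕ pre x L₂) ⊕ (pre x R₁ ⊕ pre x R₂)) ⊕ (neg (pre x E₁) ⊕ neg (pre x E₂))
    ≈⟨ solve 6 (λ l₁ l₂ r₁ r₂ e₁ e₂ → ((l₁ ⊞ l₂) ⊞ (r₁ ⊞ r₂)) ⊞ (e₁ ⊞ e₂) ⊜ ((l₁ ⊞ r₁) ⊞ e₁) ⊞ ((l₂ ⊞ r₂) ⊞ e₂)) ≈-refl
               (pre x L₁) (pre x L₂) (pre x R₁) (pre x R₂) (neg (pre x E₁)) (neg (pre x E₂)) ⟩
  ((pre x L₁ ⊕ pre x R₁) ⊖ pre x E₁) ⊕ ((pre x L₂ ⊕ pre x R₂) ⊖ pre x E₂)
    ≡⟨ cong₂ _⊕_ (pre-⊕⊖ x L₁ R₁ E₁) (pre-⊕⊖ x L₂ R₂ E₂) ⟨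
  pre x (blockShuffle p (suc q) W) ⊕ pre x (blockShuffle (suc p) q W) ∎
  where
  open ≈-Reasoning
  L₁ R₁ E₁ L₂ R₂ E₂ : Poly
  L₁ = leftFirst p (suc q) W
  R₁ = rightFirst p (suc q) W
  E₁ = emptyCorrection p (suc q) W
  L₂ = leftFirst (suc p) q W
  R₂ = rightFirst (suc p) q W
  E₂ = emptyCorrection (suc p) q W

z⧢z++≈blockShuffle : ∀ p q W → z (suc p) ⧢ (z (suc q) ++ W) ≈ blockShuffle p q W
z⧢z++≈blockShuffle zero zero W = ≈-trans (⊖-interchange ⟦ y ∷ y ∷ W ⟧ (pre y (z 1 ⧢ W)) (δρ [] y (y ∷ W)) (δρ W y (z 1)))
  (≈-sym (blockShuffle-zero-zero W))
z⧢z++≈blockShuffle zero (suc q) W = begin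
  z 1 ⧢ (z (suc (suc q)) ++ W)
    ≈⟨ ⊖-interchange ⟦ y ∷ V ⟧ (pre x (z 1 ⧢ (z (suc q) ++ W))) (δρ [] y V) (δρ (z (suc q) ++ W) x (z 1)) ⟩
  pairTerm 1 (suc (suc q)) (suc (suc (suc q))) W ⊕ (pre x (z 1 ⧢ (z (suc q) ++ W)) ⊖ δρ (z (suc q) ++ W) x (z 1))
    ≈⟨ ⊕-cong (≈-refl {pairTerm 1 (suc (suc q)) (suc (suc (suc q))) W})
         (≈-trans (⊖-δρ-x (pre x (z 1 ⧢ (z (suc q) ++ W))) (z (suc q) ++ W) (z 1)) (pre-cong x (z⧢z++≈blockShuffle zero q W))) ⟩
  pairTerm 1 (suc (suc q)) (suc (suc (suc q))) W ⊕ pre x (blockShuffle 0 q W)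
    ≈⟨ blockShuffle-zero-suc q W ⟨
  blockShuffle 0 (suc q) W ∎
  where
  open ≈-Reasoning
  V : Word
  V = z (suc (suc q)) ++ W
z⧢z++≈blockShuffle (suc p) zero W = begin
  z (suc (suc p)) ⧢ (y ∷ W)
    ≈⟨ ⊖-interchange (pre x S) Y (δρ (z (suc p)) x (y ∷ W)) D ⟩
  (pre x S ⊖ δρ (z (suc p)) x (y ∷ W)) ⊕ (Y ⊖ D)
    ≈⟨ ⊕-cong (≈-trans (⊖-δρ-x (pre x S) (z (suc p)) (y ∷ W)) (pre-cong x (z⧢z++≈blockShuffle p zero W))) (≈-refl {Y ⊖ D}) ⟩
  pre x (blockShuffle p 0 W) ⊕ (Y ⊖ D)
    ≈⟨ blockShuffle-suc-zero p W ⟨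
  blockShuffle (suc p) 0 W ∎
  where
  open ≈-Reasoning
  S Y D : Poly
  S = z (suc p) ⧢ (y ∷ W)
  Y = pre y (z (suc (suc p)) ⧢ W)
  D = δρ W y (z (suc (suc p)))
z⧢z++≈blockShuffle (suc p) (suc q) W = begin
  z (suc (suc p)) ⧢ (x ∷ V)
    ≈⟨ ⊖-interchange (pre x S₁) (pre x S₂) (δρ (z (suc p)) x (x ∷ V)) (δρ V x (z (suc (suc p)))) ⟩
  (pre x S₁ ⊖ δρ (z (suc p)) x (x ∷ V)) ⊕ (pre x S₂ ⊖ δρ V x (z (suc (suc p))))
    ≈⟨ ⊕-cong (≈-trans (⊖-δρ-x (pre x S₁) (z (suc p)) (x ∷ V)) (pre-cong x (z⧢z++≈blockShuffle p (suc q) W)))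
              (≈-trans (⊖-δρ-x (pre x S₂) V (z (suc (suc p)))) (pre-cong x (z⧢z++≈blockShuffle (suc p) q W))) ⟩
  pre x (blockShuffle p (suc q) W) ⊕ pre x (blockShuffle (suc p) q W)
    ≈⟨ blockShuffle-suc-suc p q W ⟨
  blockShuffle (suc p) (suc q) W ∎
  where
  open ≈-Reasoning
  V : Word
  V = z (suc q) ++ W
  S₁ S₂ : Poly
  S₁ = z (suc p) ⧢ (x ∷ V)
  S₂ = z (suc (suc p)) ⧢ V

⧢-[] : ∀ u → u ⧢ [] ≡ ⟦ u ⟧
⧢-[] []      = refl
⧢-[] (a ∷ u) = refl

-- The right-hand side

innerSum : ℕ → ℕ → List ℕ → Poly
innerSum j M ks = Σcomp (suc (suc j)) M (innerSummand ks j)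

lastSummand : List ℕ → List ℕ → Poly
lastSummand ks α =
  let j = length ks ∸ 1 in
  let ab = pairAt j α in
  scale (toℚ (prodBinom α ks)) 0 (⟦ zs α ⟧ ⊖ scale 1ℚ 1 ⟦ zs (take j α) ++ z (proj₁ ab ℕ.+ proj₂ ab) ⟧)

lastSum : ℕ → List ℕ → Poly
lastSum M ks = Σcomp (suc (length ks)) M (lastSummand ks)

firstSum≈⨁innerSum : ∀ l ks → firstSum l ks ≈ ⨁[ j < length ks ] innerSum j (l ℕ.+ sum (take (suc j) ks)) ks
firstSum≈⨁innerSum l ks = ≈-trans (≡⇒≈ (Σ-list-upTo (length ks) _))
  (⨁-cong (length ks) (λ j → Σ-compositions (suc (suc j)) (l ℕ.+ sum (take (suc j) ks)) (innerSummand ks j)))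

secondSum≈lastSum : ∀ l ks → secondSum l ks ≈ lastSum (l ℕ.+ sum ks) ks
secondSum≈lastSum l ks = Σ-compositions (suc (length ks)) (l ℕ.+ sum ks) (lastSummand ks)

firstBlock : ℕ → ℕ → Poly → Poly
firstBlock k a p = binom a (+ (k ∸ 1)) · preWord (z (suc a)) p

firstBlock-cong : ∀ k a {p p'} → p ≈ p' → firstBlock k a p ≈ firstBlock k a p'
firstBlock-cong k a e = ·-cong (binom a (+ (k ∸ 1))) (preWord-cong (z (suc a)) e)

firstBlock-⊕ : ∀ k a p q → firstBlock k a (p ⊕ q) ≡ firstBlock k a p ⊕ firstBlock k a q
firstBlock-⊕ k a p q = trans (cong (binom a (+ (k ∸ 1)) ·_) (preWord-⊕ (z (suc a)) p q))
  (·-⊕ (binom a (+ (k ∸ 1))) (preWord (z (suc a)) p) (preWord (z (suc a)) q))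

firstBlock-⨁ : ∀ k a n f → firstBlock k a (⨁ n f) ≡ ⨁[ j < n ] firstBlock k a (f j)
firstBlock-⨁ k a n f = trans (cong (binom a (+ (k ∸ 1)) ·_) (map-⨁ _ n f)) (map-⨁ _ n _)

firstBlock-Σcomp : ∀ k a p M f → firstBlock k a (Σcomp p M f) ≡ Σcomp p M (firstBlock k a ∘ f)
firstBlock-Σcomp k a p M f = trans (cong (binom a (+ (k ∸ 1)) ·_) (map-Σcomp _ p M f)) (map-Σcomp _ p M _)

firstTwo : List ℕ → ℕ × ℕ
firstTwo (a ∷ b ∷ _) = a , b
firstTwo _           = 0 , 0

pairAt≡firstTwo∘drop : ∀ j α → pairAt j α ≡ firstTwo (drop j α)
pairAt≡firstTwo∘drop j α with drop j α
... | a ∷ b ∷ _ = refl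
... | []        = refl
... | _ ∷ []    = refl

pairAt-suc : ∀ j c β → pairAt (suc j) (c ∷ β) ≡ pairAt j β
pairAt-suc j c β = trans (pairAt≡firstTwo∘drop (suc j) (c ∷ β)) (sym (pairAt≡firstTwo∘drop j β))

-- innerSummand with the pair (α_{j+1}, α_{j+2}) abstracted, so that it is stable under consing onto α.
innerTerm : List ℕ → ℕ → List ℕ → ℕ → ℕ → Poly
innerTerm ks j α a b = scale (toℚ (prodBinom (take j α) ks ℕ.* binom (a ∸ 1) (headOr0 (drop j ks) ⊝ b))) 0
  (⟦ zs α ++ zs (drop (suc j) ks) ⟧ ⊖ scale 1ℚ 1 ⟦ zs (take j α) ++ z (a ℕ.+ b) ++ zs (drop (suc j) ks) ⟧)

innerSummand≡innerTerm : ∀ ks j α → innerSummand ks j α ≡ innerTerm ks j α (proj₁ (pairAt j α)) (proj₂ (pairAt j α))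
innerSummand≡innerTerm ks j α with pairAt j α
... | (a , b) = refl

lastTerm : List ℕ → List ℕ → ℕ → ℕ → Poly
lastTerm ks α a b = scale (toℚ (prodBinom α ks)) 0 (⟦ zs α ⟧ ⊖ scale 1ℚ 1 ⟦ zs (take (length ks ∸ 1) α) ++ z (a ℕ.+ b) ⟧)

innerTerm-cons : ∀ k ks j a β a' b' → innerTerm (k ∷ ks) (suc j) (suc a ∷ β) a' b' ≈ firstBlock k a (innerTerm ks j β a' b')
innerTerm-cons k ks j a β a' b' = ≈-sym (begin
  firstBlock k a (innerTerm ks j β a' b')
    ≡⟨ cong (c ·_) (preWord-scale u (toℚ (d ℕ.* e)) 0 X) ⟩
  c · ((d ℕ.* e) · preWord u X)
    ≈⟨ ·-assoc c (d ℕ.* e) (preWord u X) ⟩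
  (c ℕ.* (d ℕ.* e)) · preWord u X
    ≡⟨ cong₂ _·_ (sym (ℕP.*-assoc c d e))
         (cong₂ (λ w w' → ⟦ w ⟧ ⊖ scale 1ℚ 1 ⟦ w' ⟧) (sym (LP.++-assoc u (zs β) R)) (sym (LP.++-assoc u (zs (take j β)) (z (a' ℕ.+ b') ++ R)))) ⟩
  innerTerm (k ∷ ks) (suc j) (suc a ∷ β) a' b' ∎)
  where
  open ≈-Reasoning
  c d e : ℕ
  c = binom a (+ (k ∸ 1))
  d = prodBinom (take j β) ks
  e = binom (a' ∸ 1) (headOr0 (drop j ks) ⊝ b')
  u R : Word
  u = z (suc a)
  R = zs (drop (suc j) ks)
  X : Poly
  X = ⟦ zs β ++ R ⟧ ⊖ scale 1ℚ 1 ⟦ zs (take j β) ++ z (a' ℕ.+ b') ++ R ⟧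

innerSummand-cons : ∀ k ks j a β → innerSummand (k ∷ ks) (suc j) (suc a ∷ β) ≈ firstBlock k a (innerSummand ks j β)
innerSummand-cons k ks j a β = begin
  innerSummand (k ∷ ks) (suc j) (suc a ∷ β)
    ≡⟨ innerSummand≡innerTerm (k ∷ ks) (suc j) (suc a ∷ β) ⟩
  innerTerm (k ∷ ks) (suc j) (suc a ∷ β) (proj₁ (pairAt (suc j) (suc a ∷ β))) (proj₂ (pairAt (suc j) (suc a ∷ β)))
    ≡⟨ cong (λ ab → innerTerm (k ∷ ks) (suc j) (suc a ∷ β) (proj₁ ab) (proj₂ ab)) (pairAt-suc j (suc a) β) ⟩
  innerTerm (k ∷ ks) (suc j) (suc a ∷ β) (proj₁ (pairAt j β)) (proj₂ (pairAt j β))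
    ≈⟨ innerTerm-cons k ks j a β (proj₁ (pairAt j β)) (proj₂ (pairAt j β)) ⟩
  firstBlock k a (innerTerm ks j β (proj₁ (pairAt j β)) (proj₂ (pairAt j β)))
    ≡⟨ cong (firstBlock k a) (innerSummand≡innerTerm ks j β) ⟨
  firstBlock k a (innerSummand ks j β) ∎
  where open ≈-Reasoning

lastTerm-cons : ∀ k k' ks a β a' b' → lastTerm (k ∷ k' ∷ ks) (suc a ∷ β) a' b' ≈ firstBlock k a (lastTerm (k' ∷ ks) β a' b')
lastTerm-cons k k' ks a β a' b' = ≈-sym (begin
  firstBlock k a (lastTerm (k' ∷ ks) β a' b')
    ≡⟨ cong (c ·_) (preWord-scale u (toℚ d) 0 X) ⟩
  c · (d · preWord u X)
    ≈⟨ ·-assoc c d (preWord u X) ⟩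
  (c ℕ.* d) · preWord u X
    ≡⟨ cong (λ w → (c ℕ.* d) · (⟦ u ++ zs β ⟧ ⊖ scale 1ℚ 1 ⟦ w ⟧)) (sym (LP.++-assoc u (zs (take (length ks) β)) (z (a' ℕ.+ b')))) ⟩
  lastTerm (k ∷ k' ∷ ks) (suc a ∷ β) a' b' ∎)
  where
  open ≈-Reasoning
  c d : ℕ
  c = binom a (+ (k ∸ 1))
  d = prodBinom β (k' ∷ ks)
  u : Word
  u = z (suc a)
  X : Poly
  X = ⟦ zs β ⟧ ⊖ scale 1ℚ 1 ⟦ zs (take (length ks) β) ++ z (a' ℕ.+ b') ⟧

lastSummand-cons : ∀ k k' ks a β → lastSummand (k ∷ k' ∷ ks) (suc a ∷ β) ≈ firstBlock k a (lastSummand (k' ∷ ks) β)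
lastSummand-cons k k' ks a β = ≈-trans
  (≡⇒≈ (cong (λ ab → lastTerm (k ∷ k' ∷ ks) (suc a ∷ β) (proj₁ ab) (proj₂ ab)) (pairAt-suc (length ks) (suc a) β)))
  (lastTerm-cons k k' ks a β (proj₁ (pairAt (length ks) β)) (proj₂ (pairAt (length ks) β)))

innerSum-cons : ∀ j M k ks → innerSum (suc j) M (k ∷ ks) ≈ ⨁[ a < M ] firstBlock k a (innerSum j (M ∸ suc a) ks)
innerSum-cons j M k ks = ⨁-cong M λ a → ≈-trans
  (Σcomp-cong (suc (suc j)) (M ∸ suc a) (innerSummand-cons k ks j a))
  (≡⇒≈ (sym (firstBlock-Σcomp k a (suc (suc j)) (M ∸ suc a) (innerSummand ks j))))

lastSum-cons : ∀ M k k' ks → lastSum M (k ∷ k' ∷ ks) ≈ ⨁[ a < M ] firstBlock k a (lastSum (M ∸ suc a) (k' ∷ ks))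
lastSum-cons M k k' ks = ⨁-cong M λ a → ≈-trans
  (Σcomp-cong (suc (suc (length ks))) (M ∸ suc a) (lastSummand-cons k k' ks a))
  (≡⇒≈ (sym (firstBlock-Σcomp k a (suc (suc (length ks))) (M ∸ suc a) (lastSummand (k' ∷ ks)))))

-- C(a, k − 1) = 0 unless a ≥ k − 1, and then M − a − 1 ≤ S.
⨁-firstBlock-vanish : ∀ k M S (h : ℕ → Poly) → M ≤ k ℕ.+ S → (∀ M' → M' ≤ S → h M' ≈ []) →
                      ⨁[ a < M ] firstBlock k a (h (M ∸ suc a)) ≈ []
⨁-firstBlock-vanish k M S h M≤k+S h-vanish = ⨁-vanish M summand
  where
  summand : ∀ a → a < M → firstBlock k a (h (M ∸ suc a)) ≈ []
  summand a _ with k ∸ 1 ℕ.≤? a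
  ... | yes k∸1≤a = firstBlock-cong k a (h-vanish (M ∸ suc a) (begin
    M ∸ suc a          ≤⟨ ℕP.∸-mono M≤k+S (ℕP.≤-trans (ℕP.m≤n+m∸n k 1) (s≤s k∸1≤a)) ⟩
    k ℕ.+ S ∸ k        ≡⟨ ℕP.m+n∸m≡n k S ⟩
    S                  ∎))
    where open ℕP.≤-Reasoning
  ... | no  k∸1≰a = ·-vanish _ (k>n⇒nCk≡0 (ℕP.≰⇒> k∸1≰a))

innerSum-vanish : ∀ j M ks → j < length ks → M ≤ sum (take (suc j) ks) → innerSum j M ks ≈ []
innerSum-vanish zero zero          (k ∷ ks) _ _ = ≈-refl
innerSum-vanish zero (suc zero)    (k ∷ ks) _ _ = ≈-refl
innerSum-vanish zero (suc (suc n)) (k ∷ ks) _ M≤k+0 = ≈-trans (Σcomp-2 n (innerSummand (k ∷ ks) 0)) (⨁-vanish (suc n) summand)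
  where
  summand : ∀ a → a < suc n → innerSummand (k ∷ ks) 0 (suc a ∷ suc (n ∸ a) ∷ []) ≈ []
  summand a (s≤s a≤n) = ·-vanish _ (cong (1 ℕ.*_) (trans
      (cong (binom a) (⊝-≤ k (suc (n ∸ a)) (ℕP.m+n≤o⇒n≤o (suc a) a+b≤k)))
      (k>n⇒nCk≡0 (ℕP.m+n≤o⇒m≤o∸n (suc a) a+b≤k))))
    where
    a+b≤k : suc a ℕ.+ suc (n ∸ a) ≤ k
    a+b≤k = ℕP.≤-trans (ℕP.≤-reflexive (cong suc (trans (ℕP.+-suc a (n ∸ a)) (cong suc (ℕP.m+[n∸m]≡n a≤n)))))
                       (ℕP.≤-trans M≤k+0 (ℕP.≤-reflexive (ℕP.+-identityʳ k)))
innerSum-vanish (suc j) M (k ∷ ks) (s≤s j<) M≤ = ≈-trans (innerSum-cons j M k ks)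
  (⨁-firstBlock-vanish k M (sum (take (suc j) ks)) (λ M' → innerSum j M' ks) M≤ (λ M' le → innerSum-vanish j M' ks j< le))

lastSum-vanish : ∀ M ks → M ≤ sum ks → lastSum M ks ≈ []
lastSum-vanish zero          []       _ = ≈-refl
lastSum-vanish zero          (k ∷ []) _ = ≈-refl
lastSum-vanish (suc zero)    (k ∷ []) _ = ≈-refl
lastSum-vanish (suc (suc n)) (k ∷ []) M≤k+0 = ≈-trans (Σcomp-2 n (lastSummand (k ∷ []))) (⨁-vanish (suc n) summand)
  where
  summand : ∀ a → a < suc n → lastSummand (k ∷ []) (suc a ∷ suc (n ∸ a) ∷ []) ≈ []
  summand a (s≤s a≤n) = ·-vanish _ (cong (ℕ._* 1) (k>n⇒nCk≡0 (ℕP.m+n≤o⇒m≤o∸n (suc a)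
    (ℕP.≤-trans (ℕP.≤-reflexive (ℕP.+-comm (suc a) 1)) (ℕP.≤-trans (s≤s (s≤s a≤n))
      (ℕP.≤-trans M≤k+0 (ℕP.≤-reflexive (ℕP.+-identityʳ k))))))))
lastSum-vanish M (k ∷ k' ∷ ks) M≤ = ≈-trans (lastSum-cons M k k' ks)
  (⨁-firstBlock-vanish k M (sum (k' ∷ ks)) (λ M' → lastSum M' (k' ∷ ks)) M≤ (λ M' le → lastSum-vanish M' (k' ∷ ks) le))

⨁-firstBlock-truncate : ∀ k L S (h : ℕ → Poly) → (∀ M → M ≤ S → h M ≈ []) →
  ⨁[ a < suc L ℕ.+ S ] firstBlock k a (h (suc L ℕ.+ S ∸ suc a)) ≈ ⨁[ a < L ] firstBlock k a (h (L ∸ a ℕ.+ S))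
⨁-firstBlock-truncate k L S h h-vanish = begin
  ⨁ (suc L ℕ.+ S) F   ≡⟨ cong (λ n → ⨁ n F) (ℕP.+-suc L S) ⟨
  ⨁ (L ℕ.+ suc S) F   ≈⟨ ⨁-+-vanishʳ L (suc S) F (λ i _ → firstBlock-cong k (L ℕ.+ i) (h-vanish _ (beyond i))) ⟩
  ⨁ L F               ≈⟨ ⨁-cong-< L (λ a a<L → ≡⇒≈ (cong (λ m → firstBlock k a (h m)) (ℕP.+-∸-comm S (ℕP.<⇒≤ a<L)))) ⟩
  ⨁[ a < L ] firstBlock k a (h (L ∸ a ℕ.+ S)) ∎
  where
  open ≈-Reasoning
  F : ℕ → Poly
  F a = firstBlock k a (h (suc L ℕ.+ S ∸ suc a))
  beyond : ∀ i → suc L ℕ.+ S ∸ suc (L ℕ.+ i) ≤ S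
  beyond i = ℕP.≤-trans (ℕP.≤-reflexive (ℕP.[m+n]∸[m+o]≡n∸o L S i)) (ℕP.m∸n≤m S i)

innerSum-leftFirst : ∀ p q ks → innerSum 0 (suc p ℕ.+ (suc q ℕ.+ 0)) (suc q ∷ ks) ≈ leftFirst p q (zs ks)
innerSum-leftFirst p q ks = begin
  innerSum 0 (suc p ℕ.+ (suc q ℕ.+ 0)) (suc q ∷ ks)  ≡⟨ cong (λ M → innerSum 0 M (suc q ∷ ks)) (1+p+[1+q+0]≡2+[p+q] p q) ⟩
  innerSum 0 (suc (suc n)) (suc q ∷ ks)              ≈⟨ Σcomp-2 n (innerSummand (suc q ∷ ks) 0) ⟩
  ⨁ (suc n) T                                        ≡⟨ cong (λ m → ⨁ m T) (ℕP.+-suc p q) ⟨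
  ⨁ (p ℕ.+ suc q) T                                  ≈⟨ ⨁-+-vanishˡ p (suc q) T too-short ⟩
  ⨁[ j < suc q ] T (p ℕ.+ j)                         ≈⟨ ⨁-cong-< (suc q) (λ j j≤q → ≡⇒≈ (matches j j≤q)) ⟩
  leftFirst p q W                                    ∎
  where
  open ≈-Reasoning
  n = p ℕ.+ q
  W = zs ks
  T : ℕ → Poly
  T a = innerSummand (suc q ∷ ks) 0 (suc a ∷ suc (n ∸ a) ∷ [])
  too-short : ∀ a → a < p → T a ≈ []
  too-short a a<p = ·-vanish _ (cong (1 ℕ.*_) (binom-⊝-> a (suc q) (suc (n ∸ a)) (s≤s q<n∸a)))
    where
    q<n∸a : q < n ∸ a
    q<n∸a = subst (q <_) (sym (trans (ℕP.+-∸-comm q (ℕP.<⇒≤ a<p)) (cong (ℕ._+ q) (∸-suc a<p))))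
                  (s≤s (ℕP.m≤n+m q (p ∸ suc a)))
  matches : ∀ j → j < suc q → T (p ℕ.+ j) ≡ ((p ℕ.+ j) C p) · pairTerm (suc (p ℕ.+ j)) (suc (q ∸ j)) (suc (suc n)) W
  matches j (s≤s j≤q) = ·-⟦⟧⊖t·⟦⟧-≡ coefficient first-word merged-word
    where
    rest : n ∸ (p ℕ.+ j) ≡ q ∸ j
    rest = ℕP.[m+n]∸[m+o]≡n∸o p q j
    coefficient : 1 ℕ.* binom (p ℕ.+ j) (suc q ⊝ suc (n ∸ (p ℕ.+ j))) ≡ (p ℕ.+ j) C p
    coefficient = trans (ℕP.*-identityˡ _)
      (trans (cong (λ r → binom (p ℕ.+ j) (suc q ⊝ suc r)) rest) (binom-complement p q j j≤q))
    first-word : (z (suc (p ℕ.+ j)) ++ z (suc (n ∸ (p ℕ.+ j))) ++ []) ++ W ≡ z (suc (p ℕ.+ j)) ++ z (suc (q ∸ j)) ++ W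
    first-word = trans (LP.++-assoc (z (suc (p ℕ.+ j))) _ W) (cong (z (suc (p ℕ.+ j)) ++_)
      (trans (cong (_++ W) (LP.++-identityʳ (z (suc (n ∸ (p ℕ.+ j)))))) (cong (λ r → z (suc r) ++ W) rest)))
    merged-word : z (suc (p ℕ.+ j) ℕ.+ suc (n ∸ (p ℕ.+ j))) ++ W ≡ z (suc (suc n)) ++ W
    merged-word = cong (λ r → z r ++ W) (trans (cong (λ r → suc (p ℕ.+ j) ℕ.+ suc r) rest)
      (cong suc (trans (ℕP.+-suc (p ℕ.+ j) (q ∸ j)) (cong suc (trans (ℕP.+-assoc p j (q ∸ j)) (cong (p ℕ.+_) (ℕP.m+[n∸m]≡n j≤q)))))))

lastSum-single : ∀ p q → lastSum (suc p ℕ.+ (suc q ℕ.+ 0)) (suc q ∷ []) ≈ rightFirst p q [] ⊖ emptyCorrection p q []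
lastSum-single p q = begin
  lastSum (suc p ℕ.+ (suc q ℕ.+ 0)) (suc q ∷ [])  ≡⟨ cong (λ M → lastSum M (suc q ∷ [])) (1+p+[1+q+0]≡2+[p+q] p q) ⟩
  lastSum (suc (suc n)) (suc q ∷ [])              ≈⟨ Σcomp-2 n (lastSummand (suc q ∷ [])) ⟩
  ⨁ (suc n) T                                     ≡⟨ cong (λ m → ⨁ m T) n+1≡q+[p+1] ⟩
  ⨁ (q ℕ.+ suc p) T                               ≈⟨ ⨁-+-vanishˡ q (suc p) T too-short ⟩
  ⨁[ i < suc p ] T (q ℕ.+ i)                      ≈⟨ ⨁-cong-< (suc p) (λ i i≤p → ≡⇒≈ (matches i i≤p)) ⟩
  ⨁[ i < suc p ] (B i ⊕ neg (t· E i))             ≈⟨ ⨁-⊖-t· (suc p) B E ⟩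
  ⨁ (suc p) B ⊖ t· ⨁ (suc p) E                    ≡⟨ cong (λ r → r ⊖ emptyCorrection p q []) (⨁-cong≡ (suc p) unshuffle) ⟩
  rightFirst p q [] ⊖ emptyCorrection p q []      ∎
  where
  open ≈-Reasoning
  n = p ℕ.+ q
  n+1≡q+[p+1] : suc n ≡ q ℕ.+ suc p
  n+1≡q+[p+1] = trans (cong suc (ℕP.+-comm p q)) (sym (ℕP.+-suc q p))
  T B E : ℕ → Poly
  T a = lastSummand (suc q ∷ []) (suc a ∷ suc (n ∸ a) ∷ [])
  B i = ((q ℕ.+ i) C q) · ⟦ z (suc (q ℕ.+ i)) ++ z (suc (p ∸ i)) ⟧
  E i = ((q ℕ.+ i) C q) · ⟦ z (suc (suc (q ℕ.+ p))) ⟧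
  too-short : ∀ a → a < q → T a ≈ []
  too-short a a<q = ·-vanish _ (cong (ℕ._* 1) (k>n⇒nCk≡0 a<q))
  unshuffle : ∀ i → B i ≡ ((q ℕ.+ i) C q) · preWord (z (suc (q ℕ.+ i))) (z (suc (p ∸ i)) ⧢ [])
  unshuffle i = cong (λ r → ((q ℕ.+ i) C q) · preWord (z (suc (q ℕ.+ i))) r) (sym (⧢-[] (z (suc (p ∸ i)))))
  matches : ∀ i → i < suc p → T (q ℕ.+ i) ≡ B i ⊕ neg (t· E i)
  matches i (s≤s i≤p) = sym (trans (sym (·-⊖-t· ((q ℕ.+ i) C q) ⟦ z (suc (q ℕ.+ i)) ++ z (suc (p ∸ i)) ⟧ ⟦ z (suc (suc (q ℕ.+ p))) ⟧))
    (·-⟦⟧⊖t·⟦⟧-≡ (sym (ℕP.*-identityʳ ((q ℕ.+ i) C q))) first-word merged-word))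
    where
    rest : n ∸ (q ℕ.+ i) ≡ p ∸ i
    rest = trans (cong (_∸ (q ℕ.+ i)) (ℕP.+-comm p q)) (ℕP.[m+n]∸[m+o]≡n∸o q p i)
    first-word : z (suc (q ℕ.+ i)) ++ z (suc (p ∸ i)) ≡ z (suc (q ℕ.+ i)) ++ z (suc (n ∸ (q ℕ.+ i))) ++ []
    first-word = cong (z (suc (q ℕ.+ i)) ++_) (sym (trans (LP.++-identityʳ _) (cong (λ r → z (suc r)) rest)))
    merged-word : z (suc (suc (q ℕ.+ p))) ≡ z (suc (q ℕ.+ i) ℕ.+ suc (n ∸ (q ℕ.+ i)))
    merged-word = cong z (sym (trans (cong (λ r → suc (q ℕ.+ i) ℕ.+ suc r) rest)
      (cong suc (trans (ℕP.+-suc (q ℕ.+ i) (p ∸ i)) (cong suc (trans (ℕP.+-assoc q i (p ∸ i)) (cong (q ℕ.+_) (ℕP.m+[n∸m]≡n i≤p))))))))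

⨁-firstBlock-shuffle : ∀ p q W → ⨁[ a < p ℕ.+ suc q ] firstBlock (suc q) a (z (p ℕ.+ suc q ∸ a) ⧢ W) ≈ rightFirst p q W
⨁-firstBlock-shuffle p q W = begin
  ⨁ L F                       ≡⟨ cong (λ m → ⨁ m F) L≡q+[p+1] ⟩
  ⨁ (q ℕ.+ suc p) F           ≈⟨ ⨁-+-vanishˡ q (suc p) F (λ a a<q → ·-vanish _ (k>n⇒nCk≡0 a<q)) ⟩
  ⨁[ i < suc p ] F (q ℕ.+ i)  ≈⟨ ⨁-cong-< (suc p) (λ i i≤p → ≡⇒≈ (reindex i i≤p)) ⟩
  rightFirst p q W            ∎
  where
  open ≈-Reasoning
  L = p ℕ.+ suc q
  F : ℕ → Poly
  F a = firstBlock (suc q) a (z (L ∸ a) ⧢ W)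
  L≡q+[p+1] : L ≡ q ℕ.+ suc p
  L≡q+[p+1] = trans (ℕP.+-suc p q) (trans (cong suc (ℕP.+-comm p q)) (sym (ℕP.+-suc q p)))
  reindex : ∀ i → i < suc p → F (q ℕ.+ i) ≡ ((q ℕ.+ i) C q) · preWord (z (suc (q ℕ.+ i))) (z (suc (p ∸ i)) ⧢ W)
  reindex i (s≤s i≤p) = cong (λ m → ((q ℕ.+ i) C q) · preWord (z (suc (q ℕ.+ i))) (z m ⧢ W))
    (trans (cong (_∸ (q ℕ.+ i)) L≡q+[p+1]) (trans (ℕP.[m+n]∸[m+o]≡n∸o q (suc p) i) (ℕP.+-∸-assoc 1 i≤p)))

innerSums-cons-truncated : ∀ p q ks →
  ⨁[ j < length ks ] innerSum (suc j) (suc p ℕ.+ (suc q ℕ.+ sum (take (suc j) ks))) (suc q ∷ ks) ≈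
  ⨁[ a < p ℕ.+ suc q ] ⨁[ j < length ks ] firstBlock (suc q) a (innerSum j (p ℕ.+ suc q ∸ a ℕ.+ sum (take (suc j) ks)) ks)
innerSums-cons-truncated p q ks = ≈-trans (⨁-cong-< (length ks) peel)
  (⨁-comm (length ks) (p ℕ.+ suc q) (λ j a → firstBlock (suc q) a (innerSum j (p ℕ.+ suc q ∸ a ℕ.+ sum (take (suc j) ks)) ks)))
  where
  peel : ∀ j → j < length ks →
    innerSum (suc j) (suc p ℕ.+ (suc q ℕ.+ sum (take (suc j) ks))) (suc q ∷ ks) ≈
    ⨁[ a < p ℕ.+ suc q ] firstBlock (suc q) a (innerSum j (p ℕ.+ suc q ∸ a ℕ.+ sum (take (suc j) ks)) ks)
  peel j j<len = ≈-trans (innerSum-cons j (suc p ℕ.+ (suc q ℕ.+ S)) (suc q) ks)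
    (≈-trans (≡⇒≈ (cong (λ M → ⨁[ a < M ] firstBlock (suc q) a (innerSum j (M ∸ suc a) ks)) (sym (ℕP.+-assoc (suc p) (suc q) S))))
      (⨁-firstBlock-truncate (suc q) (p ℕ.+ suc q) S (λ M → innerSum j M ks) (λ M M≤S → innerSum-vanish j M ks j<len M≤S)))
    where S = sum (take (suc j) ks)

lastSum-cons-truncated : ∀ p q k ks →
  lastSum (suc p ℕ.+ (suc q ℕ.+ sum (k ∷ ks))) (suc q ∷ k ∷ ks) ≈
  ⨁[ a < p ℕ.+ suc q ] firstBlock (suc q) a (lastSum (p ℕ.+ suc q ∸ a ℕ.+ sum (k ∷ ks)) (k ∷ ks))
lastSum-cons-truncated p q k ks = ≈-trans (lastSum-cons (suc p ℕ.+ (suc q ℕ.+ S)) (suc q) k ks)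
  (≈-trans (≡⇒≈ (cong (λ M → ⨁[ a < M ] firstBlock (suc q) a (lastSum (M ∸ suc a) (k ∷ ks))) (sym (ℕP.+-assoc (suc p) (suc q) S))))
    (⨁-firstBlock-truncate (suc q) (p ℕ.+ suc q) S (λ M → lastSum M (k ∷ ks)) (λ M M≤S → lastSum-vanish M (k ∷ ks) M≤S)))
  where S = sum (k ∷ ks)

firstBlock-firstSum⊕secondSum : ∀ k a l ks →
  firstBlock k a (firstSum l ks ⊕ secondSum l ks) ≈
  (⨁[ j < length ks ] firstBlock k a (innerSum j (l ℕ.+ sum (take (suc j) ks)) ks)) ⊕ firstBlock k a (lastSum (l ℕ.+ sum ks) ks)
firstBlock-firstSum⊕secondSum k a l ks = ≈-trans (≡⇒≈ (firstBlock-⊕ k a (firstSum l ks) (secondSum l ks)))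
  (⊕-cong (≈-trans (firstBlock-cong k a (firstSum≈⨁innerSum l ks)) (≡⇒≈ (firstBlock-⨁ k a (length ks) _)))
          (firstBlock-cong k a (secondSum≈lastSum l ks)))

firstSum⊕secondSum-single : ∀ p q → firstSum (suc p) (suc q ∷ []) ⊕ secondSum (suc p) (suc q ∷ []) ≈ blockShuffle p q []
firstSum⊕secondSum-single p q = begin
  firstSum (suc p) (suc q ∷ []) ⊕ secondSum (suc p) (suc q ∷ [])
    ≈⟨ ⊕-cong (firstSum≈⨁innerSum (suc p) (suc q ∷ [])) (secondSum≈lastSum (suc p) (suc q ∷ [])) ⟩
  (innerSum 0 M (suc q ∷ []) ⊕ []) ⊕ lastSum M (suc q ∷ [])
    ≈⟨ ⊕-cong (≈-trans (⊕-identityʳ _) (innerSum-leftFirst p q [])) (lastSum-single p q) ⟩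
  leftFirst p q [] ⊕ (rightFirst p q [] ⊖ emptyCorrection p q [])
    ≈⟨ ⊕-assoc (leftFirst p q []) (rightFirst p q []) (neg (emptyCorrection p q [])) ⟨
  blockShuffle p q [] ∎
  where
  open ≈-Reasoning
  M = suc p ℕ.+ (suc q ℕ.+ 0)

firstSum⊕secondSum-cons : ∀ p q k ks → let L = p ℕ.+ suc q in
  firstSum (suc p) (suc q ∷ k ∷ ks) ⊕ secondSum (suc p) (suc q ∷ k ∷ ks) ≈
  leftFirst p q (zs (k ∷ ks)) ⊕ (⨁[ a < L ] firstBlock (suc q) a (firstSum (L ∸ a) (k ∷ ks) ⊕ secondSum (L ∸ a) (k ∷ ks)))
firstSum⊕secondSum-cons p q k ks = begin
  firstSum (suc p) (suc q ∷ ks') ⊕ secondSum (suc p) (suc q ∷ ks')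
    ≈⟨ ⊕-cong (firstSum≈⨁innerSum (suc p) (suc q ∷ ks')) (secondSum≈lastSum (suc p) (suc q ∷ ks')) ⟩
  (innerSum 0 (suc p ℕ.+ (suc q ℕ.+ 0)) (suc q ∷ ks') ⊕ Inner) ⊕ Last
    ≈⟨ ⊕-assoc (innerSum 0 (suc p ℕ.+ (suc q ℕ.+ 0)) (suc q ∷ ks')) Inner Last ⟩
  innerSum 0 (suc p ℕ.+ (suc q ℕ.+ 0)) (suc q ∷ ks') ⊕ (Inner ⊕ Last)
    ≈⟨ ⊕-cong (innerSum-leftFirst p q ks') (⊕-cong (innerSums-cons-truncated p q ks') (lastSum-cons-truncated p q k ks)) ⟩
  leftFirst p q (zs ks') ⊕ (⨁ L (λ a → ⨁[ j < length ks' ] I a j) ⊕ ⨁ L F)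
    ≈⟨ ⊕-cong (≈-refl {leftFirst p q (zs ks')}) (≈-sym (⨁-⊕ L (λ a → ⨁[ j < length ks' ] I a j) F)) ⟩
  leftFirst p q (zs ks') ⊕ (⨁[ a < L ] ((⨁[ j < length ks' ] I a j) ⊕ F a))
    ≈⟨ ⊕-cong (≈-refl {leftFirst p q (zs ks')}) (⨁-cong L (λ a → ≈-sym (firstBlock-firstSum⊕secondSum (suc q) a (L ∸ a) ks'))) ⟩
  leftFirst p q (zs ks') ⊕ (⨁[ a < L ] firstBlock (suc q) a (firstSum (L ∸ a) ks' ⊕ secondSum (L ∸ a) ks')) ∎
  where
  open ≈-Reasoning
  ks' = k ∷ ks
  L = p ℕ.+ suc q
  Inner Last : Poly
  Inner = ⨁[ j < length ks' ] innerSum (suc j) (suc p ℕ.+ (suc q ℕ.+ sum (take (suc j) ks'))) (suc q ∷ ks')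
  Last  = lastSum (suc p ℕ.+ (suc q ℕ.+ sum ks')) (suc q ∷ ks')
  I : ℕ → ℕ → Poly
  I a j = firstBlock (suc q) a (innerSum j (L ∸ a ℕ.+ sum (take (suc j) ks')) ks')
  F : ℕ → Poly
  F a = firstBlock (suc q) a (lastSum (L ∸ a ℕ.+ sum ks') ks')

emptyCorrection-++-y : ∀ p q u v → emptyCorrection p q (u ++ y ∷ v) ≡ []
emptyCorrection-++-y p q []      v = refl
emptyCorrection-++-y p q (_ ∷ _) v = refl

blockShuffle-nonempty : ∀ p q k ks → blockShuffle p q (zs (k ∷ ks)) ≈ leftFirst p q (zs (k ∷ ks)) ⊕ rightFirst p q (zs (k ∷ ks))
blockShuffle-nonempty p q k ks = ≈-trans
  (≡⇒≈ (cong (λ E → (leftFirst p q W ⊕ rightFirst p q W) ⊕ neg E)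
    (trans (cong (emptyCorrection p q) (LP.++-assoc (replicate (k ∸ 1) x) (y ∷ []) (zs ks)))
           (emptyCorrection-++-y p q (replicate (k ∸ 1) x) (zs ks)))))
  (⊕-identityʳ (leftFirst p q W ⊕ rightFirst p q W))
  where W = zs (k ∷ ks)

shuffle-expansion : ∀ p q ks → All (1 ≤_) ks →
  z (suc p) ⧢ zs (suc q ∷ ks) ≈ firstSum (suc p) (suc q ∷ ks) ⊕ secondSum (suc p) (suc q ∷ ks)
shuffle-expansion p q [] _ = ≈-trans (z⧢z++≈blockShuffle p q []) (≈-sym (firstSum⊕secondSum-single p q))
shuffle-expansion p q (zero ∷ ks) (() ∷ _)
shuffle-expansion p q (suc q' ∷ ks) (_ ∷ ks≥1) = begin
  z (suc p) ⧢ (z (suc q) ++ W)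
    ≈⟨ z⧢z++≈blockShuffle p q W ⟩
  blockShuffle p q W
    ≈⟨ blockShuffle-nonempty p q (suc q') ks ⟩
  leftFirst p q W ⊕ rightFirst p q W
    ≈⟨ ⊕-cong (≈-refl {leftFirst p q W}) (≈-sym (⨁-firstBlock-shuffle p q W)) ⟩
  leftFirst p q W ⊕ (⨁[ a < L ] firstBlock (suc q) a (z (L ∸ a) ⧢ W))
    ≈⟨ ⊕-cong (≈-refl {leftFirst p q W}) (⨁-cong-< L (λ a a<L → firstBlock-cong (suc q) a (induction a a<L))) ⟩
  leftFirst p q W ⊕ (⨁[ a < L ] firstBlock (suc q) a (firstSum (L ∸ a) ks' ⊕ secondSum (L ∸ a) ks'))
    ≈⟨ firstSum⊕secondSum-cons p q (suc q') ks ⟨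
  firstSum (suc p) (suc q ∷ ks') ⊕ secondSum (suc p) (suc q ∷ ks') ∎
  where
  open ≈-Reasoning
  ks' = suc q' ∷ ks
  W = zs ks'
  L = p ℕ.+ suc q
  induction : ∀ a → a < L → z (L ∸ a) ⧢ W ≈ firstSum (L ∸ a) ks' ⊕ secondSum (L ∸ a) ks'
  induction a a<L = subst (λ l → z l ⧢ W ≈ firstSum l ks' ⊕ secondSum l ks') (sym (∸-suc a<L))
    (shuffle-expansion (L ∸ suc a) q' ks ks≥1)

mainTheorem15 : (l : ℕ) (ks : List ℕ) → 1 ≤ l → All (1 ≤_) ks → 1 ≤ length ks →
    (z l ⧢ zs ks) ≐ (firstSum l ks ⊕ secondSum l ks)
mainTheorem15 zero    ks            ()  _            _
mainTheorem15 (suc p) []            _   _            ()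
mainTheorem15 (suc p) (zero ∷ ks)   _   (() ∷ _)     _
mainTheorem15 (suc p) (suc q ∷ ks)  _   (_ ∷ ks≥1)   _ = coeff-≡ (shuffle-expansion p q ks ks≥1)
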